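{- Let $S$ be an $n\times n$ skew-conference matrix, and let $\alpha$ be a subset of $\{1,\dots,n\}$ of cardinality $k\le n/2$. Then \[(x^2+n-1)^{n/2-k}\,c_{S[\alpha]}(x)=c_{S(\alpha)}(x).\]
   Context: A skew-conference matrix of order $n$ is an $n\times n$ skew-symmetric matrix $S$ with entries in $\{0,\pm1\}$ such that $SS^\top=(n-1)I$. For a square matrix $M$, $c_M(x)=\det(xI-M)$. For $\alpha\subseteq\{1,\dots,n\}$, $S[\alpha]$ is the principal submatrix of $S$ with rows and columns indexed by $\alpha$, and $S(\alpha)$ is the principal submatrix with rows and columns indexed by the complement of $\alpha$. -}

module Defs where

open import Data.Nat as ℕ using (ℕ; zero; suc)
open import Data.Integer as ℤ using (ℤ; +_; 0ℤ; 1ℤ; -_)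
open import Data.Fin using (Fin; zero; suc; toℕ; punchIn; _≟_)
open import Data.Fin.Subset using (Subset; ∁)
open import Data.List using (List; []; _∷_; map; length; lookup)
open import Data.Vec using ([]; _∷_)
open import Data.Bool using (Bool; true; false; if_then_else_)
open import Relation.Nullary.Decidable using (⌊_⌋)
open import Relation.Binary.PropositionalEquality using (_≡_)
open import Data.Sum using (_⊎_)

Matrix : Set → ℕ → Set
Matrix A n = Fin n → Fin n → A

sumFin : (n : ℕ) → (Fin n → ℤ) → ℤ
sumFin zero    f = 0ℤ
sumFin (suc n) f = f zero ℤ.+ sumFin n (λ i → f (suc i))

δ : {n : ℕ} → Fin n → Fin n → ℤ
δ i j = if ⌊ i ≟ j ⌋ then 1ℤ else 0ℤ

record IsSkewConference (n : ℕ) (S : Matrix ℤ n) : Set where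
  field
    entries : ∀ i j → (S i j ≡ 0ℤ) ⊎ ((S i j ≡ 1ℤ) ⊎ (S i j ≡ - 1ℤ))
    skew    : ∀ i j → S j i ≡ - S i j
    orth    : ∀ i j → sumFin n (λ l → S i l ℤ.* S j l) ≡ ((+ n) ℤ.- 1ℤ) ℤ.* δ i j

-- Integer polynomials as coefficient lists (lowest degree first)

Poly : Set
Poly = List ℤ

coeff : Poly → ℕ → ℤ
coeff []      _       = 0ℤ
coeff (a ∷ p) zero    = a
coeff (a ∷ p) (suc i) = coeff p i

-- Polynomial equality: equal coefficients (trailing zeros irrelevant)
infix 4 _≈ₚ_
_≈ₚ_ : Poly → Poly → Set
p ≈ₚ q = ∀ i → coeff p i ≡ coeff q i

infixl 6 _+ₚ_ _-ₚ_
infixl 7 _*ₚ_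
infixr 8 _^ₚ_

_+ₚ_ : Poly → Poly → Poly
[]      +ₚ q       = q
(a ∷ p) +ₚ []      = a ∷ p
(a ∷ p) +ₚ (b ∷ q) = (a ℤ.+ b) ∷ (p +ₚ q)

negₚ : Poly → Poly
negₚ = map (λ a → - a)

_-ₚ_ : Poly → Poly → Poly
p -ₚ q = p +ₚ negₚ q

_*ₚ_ : Poly → Poly → Poly
[]      *ₚ q = []
(a ∷ p) *ₚ q = map (a ℤ.*_) q +ₚ (0ℤ ∷ (p *ₚ q))

constₚ : ℤ → Poly
constₚ c = c ∷ []

oneₚ : Poly
oneₚ = constₚ 1ℤ

Xₚ : Poly
Xₚ = 0ℤ ∷ 1ℤ ∷ []

_^ₚ_ : Poly → ℕ → Poly
p ^ₚ zero  = oneₚ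
p ^ₚ suc k = p *ₚ (p ^ₚ k)

sumPoly : (n : ℕ) → (Fin n → Poly) → Poly
sumPoly zero    f = []
sumPoly (suc n) f = f zero +ₚ sumPoly n (λ i → f (suc i))

signPoly : ℕ → Poly
signPoly zero          = oneₚ
signPoly (suc zero)    = constₚ (- 1ℤ)
signPoly (suc (suc k)) = signPoly k

det : (n : ℕ) → Matrix Poly n → Poly
det zero    M = oneₚ
det (suc n) M =
  sumPoly (suc n) (λ j →
    signPoly (toℕ j) *ₚ M zero j *ₚ det n (λ r c → M (suc r) (punchIn j c)))

charPoly : {n : ℕ} → Matrix ℤ n → Poly
charPoly {n} M = det n (λ i j → (if ⌊ i ≟ j ⌋ then Xₚ else []) -ₚ constₚ (M i j))

members : {n : ℕ} → Subset n → List (Fin n)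
members []           = []
members (true ∷ p)   = zero ∷ map suc (members p)
members (false ∷ p)  = map suc (members p)

principal : {n : ℕ} → Matrix ℤ n → (l : List (Fin n)) → Matrix ℤ (length l)
principal M l i j = M (lookup l i) (lookup l j)

_[_] : {n : ℕ} → Matrix ℤ n → (α : Subset n) → Matrix ℤ (length (members α))
S [ α ] = principal S (members α)

_⟨_⟩ : {n : ℕ} → Matrix ℤ n → (α : Subset n) → Matrix ℤ (length (members (∁ α)))
S ⟨ α ⟩ = principal S (members (∁ α))

{-# OPTIONS --safe #-}
module Submission where

-- Over ℤ[x] put A = xI − S and q = x² + n − 1. Skew-symmetry of S and S Sᵀ = (n − 1) I give
-- A Aᵀ = q I. For such a matrix Jacobi's complementary minor identity
--   det A · det A(α) = q ^ (n − |α|) · det A[α]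
-- follows by multiplying A with the matrix whose columns are the unit vectors e_c for c ∈ α and
-- the rows of A for c ∉ α; for α = ∅ it reads (det A)² = qⁿ. As det A and q ^ (n/2) are both
-- monic of degree n, their sum is nonzero, so det A = q ^ (n/2) in the integral domain ℤ[x], and
-- cancelling q ^ (n/2) from Jacobi's identity gives the theorem, since det A[α] = c_{S[α]}.
-- The determinant facts used (multiplicativity, invariance under transposition, expansion along
-- a unit column) all follow from the characterisation D M = det Mᵀ · D I of multilinear
-- alternating forms D.

open import Level using (_⊔_)
open import Algebra.Bundles using (CommutativeRing)
open import Data.Bool using (true; false; if_then_else_; not)
open import Data.Nat as ℕ using (ℕ; zero; suc)
import Data.Nat.Properties as ℕₚ
open import Data.Fin as Fin using (Fin; zero; suc; toℕ; punchIn; punchOut; inject₁; _≟_)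
import Data.Fin.Properties as Finₚ
open import Data.Fin.Permutation.Components using (transpose)
open import Data.Vec.Functional using (insertAt)
open import Data.List as List using (List; []; _∷_)
import Data.List.Properties as Listₚ
open import Data.Vec as Vec using ([]; _∷_; removeAt)
import Data.Vec.Properties as Vecₚ
open import Data.Fin.Subset using (Subset; ∁; ∣_∣; ⊤; ⊥)
open import Data.Fin.Subset.Properties using (∣∁p∣≡n∸∣p∣; ∣⊤∣≡n; ∣⊥∣≡0)
open import Defs using (members)
open import Data.Empty using (⊥-elim)
open import Data.Product using (Σ; _×_; _,_; proj₁; proj₂)
open import Data.Sum as Sum using (_⊎_; inj₁; inj₂; [_,_]′)
open import Function using (_∘_)
open import Relation.Nullary using (¬_; yes; no)
open import Relation.Nullary.Decidable using (⌊_⌋; dec-true; dec-false; isYes≗does; toSum)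
open import Relation.Binary.Definitions using (tri<; tri≈; tri>)
open import Relation.Binary.PropositionalEquality as ≡ using (_≡_; _≢_)

module _ {a} {X : Set a} {x y : X} where

  if-≟-refl : ∀ {n} (i : Fin n) → (if ⌊ i ≟ i ⌋ then x else y) ≡ x
  if-≟-refl i = ≡.cong (if_then x else y) (≡.trans (isYes≗does (i ≟ i)) (dec-true (i ≟ i) ≡.refl))

  if-≟-≢ : ∀ {n} {i j : Fin n} → i ≢ j → (if ⌊ i ≟ j ⌋ then x else y) ≡ y
  if-≟-≢ {i = i} {j} i≢j = ≡.cong (if_then x else y) (≡.trans (isYes≗does (i ≟ j)) (dec-false (i ≟ j) i≢j))

  if-≟-injective : ∀ {m n} {f : Fin m → Fin n} → (∀ {i j} → f i ≡ f j → i ≡ j) →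
                   ∀ i j → (if ⌊ f i ≟ f j ⌋ then x else y) ≡ (if ⌊ i ≟ j ⌋ then x else y)
  if-≟-injective {f = f} f-injective i j with i ≟ j
  ... | yes ≡.refl = if-≟-refl (f i)
  ... | no i≢j     = if-≟-≢ (i≢j ∘ f-injective)

  if-≟-punchIn : ∀ {n} (l : Fin (suc n)) (i j : Fin n) →
                 (if ⌊ punchIn l i ≟ punchIn l j ⌋ then x else y) ≡ (if ⌊ i ≟ j ⌋ then x else y)
  if-≟-punchIn l = if-≟-injective (Finₚ.punchIn-injective l _ _)

transpose-left : ∀ {n} (p q : Fin n) → transpose p q p ≡ q
transpose-left p q rewrite dec-true (p ≟ p) ≡.refl = ≡.refl

transpose-right : ∀ {n} {p q : Fin n} → p ≢ q → transpose p q q ≡ p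
transpose-right {p = p} {q} p≢q
  rewrite dec-false (q ≟ p) (p≢q ∘ ≡.sym) | dec-true (q ≟ q) ≡.refl = ≡.refl

transpose-other : ∀ {n} {p q c : Fin n} → c ≢ p → c ≢ q → transpose p q c ≡ c
transpose-other {p = p} {q} {c} c≢p c≢q
  rewrite dec-false (c ≟ p) c≢p | dec-false (c ≟ q) c≢q = ≡.refl

true≢false : true ≢ false
true≢false ()

Adjacent : ∀ {n} → Fin n → Fin n → Set
Adjacent i j = toℕ j ≡ suc (toℕ i)

adjacent⇒≢ : ∀ {n} {i j : Fin n} → Adjacent i j → i ≢ j
adjacent⇒≢ ij ≡.refl = ℕₚ.1+n≢n (≡.sym ij)

predecessor : ∀ {n} {j : Fin n} {k} → toℕ j ≡ suc k → Σ (Fin n) (λ i → Adjacent i j)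
predecessor {j = suc j₀} _ = inject₁ j₀ , ≡.cong suc (≡.sym (Finₚ.toℕ-inject₁ j₀))

toℕ≤toℕ-punchIn : ∀ {n} (l : Fin (suc n)) (b : Fin n) → toℕ b ℕ.≤ toℕ (punchIn l b)
toℕ≤toℕ-punchIn zero    b       = ℕₚ.n≤1+n (toℕ b)
toℕ≤toℕ-punchIn (suc l) zero    = ℕ.z≤n
toℕ≤toℕ-punchIn (suc l) (suc b) = ℕ.s≤s (toℕ≤toℕ-punchIn l b)

punchIn-adjacent⁻¹ : ∀ {n} (l : Fin (suc n)) {a b : Fin n} → Adjacent (punchIn l a) (punchIn l b) → Adjacent a b
punchIn-adjacent⁻¹ zero    ab = ℕₚ.suc-injective ab
punchIn-adjacent⁻¹ (suc l) {zero}  {zero}  ()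
punchIn-adjacent⁻¹ (suc l) {zero}  {suc b} ab =
  ≡.cong suc (ℕₚ.n≤0⇒n≡0 (≡.subst (toℕ b ℕ.≤_) (ℕₚ.suc-injective ab) (toℕ≤toℕ-punchIn l b)))
punchIn-adjacent⁻¹ (suc l) {suc a} {zero}  ()
punchIn-adjacent⁻¹ (suc l) {suc a} {suc b} ab = ≡.cong suc (punchIn-adjacent⁻¹ l (ℕₚ.suc-injective ab))

punchIn-adjacent : ∀ {n} {i j : Fin (suc n)} → Adjacent i j → ∀ c →
                   (punchIn j c ≡ punchIn i c) ⊎ (punchIn j c ≡ i × punchIn i c ≡ j)
punchIn-adjacent {i = zero}  {zero}        ()
punchIn-adjacent {i = zero}  {suc zero}    _ zero    = inj₂ (≡.refl , ≡.refl)
punchIn-adjacent {i = zero}  {suc zero}    _ (suc c) = inj₁ ≡.refl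
punchIn-adjacent {i = zero}  {suc (suc j)} ()
punchIn-adjacent {i = suc i} {zero}        ()
punchIn-adjacent {i = suc i} {suc j}       _  zero   = inj₁ ≡.refl
punchIn-adjacent {i = suc i} {suc j}       ij (suc c) with punchIn-adjacent {i = i} {j} (ℕₚ.suc-injective ij) c
... | inj₁ eq         = inj₁ (≡.cong suc eq)
... | inj₂ (eq , eq′) = inj₂ (≡.cong suc eq , ≡.cong suc eq′)

<⇒suc-distance : ∀ {m n} → m ℕ.< n → n ≡ suc ((n ℕ.∸ suc m) ℕ.+ m)
<⇒suc-distance {m} {n} m<n = ≡.sym (≡.trans (≡.sym (ℕₚ.+-suc (n ℕ.∸ suc m) m)) (ℕₚ.m∸n+n≡m m<n))

module _ {a} {X : Set a} where

  insertAt-at : ∀ {n} (v : Fin n → X) i x → insertAt v i x i ≡ x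
  insertAt-at         v zero    x = ≡.refl
  insertAt-at {suc n} v (suc i) x = insertAt-at (v ∘ suc) i x

  insertAt-punchIn : ∀ {n} (v : Fin n → X) i x r → insertAt v i x (punchIn i r) ≡ v r
  insertAt-punchIn         v zero    x r       = ≡.refl
  insertAt-punchIn {suc n} v (suc i) x zero    = ≡.refl
  insertAt-punchIn {suc n} v (suc i) x (suc r) = insertAt-punchIn (v ∘ suc) i x r

punchIn-view : ∀ {n} (i r : Fin (suc n)) → r ≡ i ⊎ Σ (Fin n) (λ r′ → punchIn i r′ ≡ r)
punchIn-view i r with toSum (r ≟ i)
... | inj₁ r≡i = inj₁ r≡i
... | inj₂ r≢i = inj₂ (punchOut (r≢i ∘ ≡.sym) , Finₚ.punchIn-punchOut (r≢i ∘ ≡.sym))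

punchIn-inject₁-self : ∀ {n} (x : Fin n) → punchIn (inject₁ x) x ≡ suc x
punchIn-inject₁-self zero    = ≡.refl
punchIn-inject₁-self (suc x) = ≡.cong suc (punchIn-inject₁-self x)

punchIn-suc-self : ∀ {n} (x : Fin n) → punchIn (suc x) x ≡ inject₁ x
punchIn-suc-self zero    = ≡.refl
punchIn-suc-self (suc x) = ≡.cong suc (punchIn-suc-self x)

punchIn-suc≡punchIn-inject₁ : ∀ {n} {x c : Fin n} → c ≢ x → punchIn (suc x) c ≡ punchIn (inject₁ x) c
punchIn-suc≡punchIn-inject₁ {x = zero}  {zero}  c≢x = ⊥-elim (c≢x ≡.refl)
punchIn-suc≡punchIn-inject₁ {x = zero}  {suc c} c≢x = ≡.refl
punchIn-suc≡punchIn-inject₁ {x = suc x} {zero}  c≢x = ≡.refl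
punchIn-suc≡punchIn-inject₁ {x = suc x} {suc c} c≢x = ≡.cong suc (punchIn-suc≡punchIn-inject₁ (c≢x ∘ ≡.cong suc))

cycle : ∀ {n} → Fin (suc n) → Fin (suc n) → Fin (suc n)
cycle i zero    = i
cycle i (suc c) = punchIn i c

cycle-suc : ∀ {n} (i : Fin n) c → cycle (suc i) c ≡ cycle (inject₁ i) (transpose zero (suc i) c)
cycle-suc i zero = ≡.trans (≡.sym (punchIn-inject₁-self i)) (≡.cong (cycle (inject₁ i)) (≡.sym (transpose-left zero (suc i))))
cycle-suc i (suc c) with toSum (c ≟ i)
... | inj₁ ≡.refl = ≡.trans (punchIn-suc-self i) (≡.cong (cycle (inject₁ i)) (≡.sym (transpose-right {p = zero} {q = suc i} λ ())))
... | inj₂ c≢i    = ≡.trans (punchIn-suc≡punchIn-inject₁ c≢i)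
                       (≡.cong (cycle (inject₁ i)) (≡.sym (transpose-other {p = zero} (λ ()) (c≢i ∘ Finₚ.suc-injective))))

punchIn-punchIn : ∀ {n} (j : Fin (suc (suc n))) (m j′ : Fin (suc n)) → punchIn (punchIn j m) j′ ≡ j →
                  ∀ c → punchIn (punchIn j m) (punchIn j′ c) ≡ punchIn j (punchIn m c)
punchIn-punchIn zero    m       zero     _  c = ≡.refl
punchIn-punchIn zero    m       (suc j′) ()
punchIn-punchIn (suc j) zero    j′       eq c with Finₚ.suc-injective eq
... | ≡.refl = ≡.refl
punchIn-punchIn {suc n} (suc j) (suc m) zero     ()
punchIn-punchIn {suc n} (suc j) (suc m) (suc j′) eq zero    = ≡.refl
punchIn-punchIn {suc n} (suc j) (suc m) (suc j′) eq (suc c) =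
  ≡.cong suc (punchIn-punchIn j m j′ (Finₚ.suc-injective eq) c)

module _ {a b} {X : Set a} {Y : Set b} (f : X → Y) where

  lookup-map : ∀ (l : List X) i → List.lookup (List.map f l) i ≡ f (List.lookup l (Fin.cast (Listₚ.length-map f l) i))
  lookup-map (x ∷ l) zero    = ≡.refl
  lookup-map (x ∷ l) (suc i) = lookup-map l i

  lookup-map-cast : ∀ (l : List X) i → List.lookup (List.map f l) (Fin.cast (≡.sym (Listₚ.length-map f l)) i) ≡ f (List.lookup l i)
  lookup-map-cast l i = ≡.trans (lookup-map l (Fin.cast (≡.sym (Listₚ.length-map f l)) i))
    (≡.cong (f ∘ List.lookup l) (Finₚ.cast-involutive (Listₚ.length-map f l) (≡.sym (Listₚ.length-map f l)) i))

LookupInjective : ∀ {a} {X : Set a} → List X → Set a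
LookupInjective l = ∀ {i j} → List.lookup l i ≡ List.lookup l j → i ≡ j

map-lookupInjective : ∀ {a b} {X : Set a} {Y : Set b} {f : X → Y} → (∀ {x y} → f x ≡ f y → x ≡ y) →
                      ∀ {l} → LookupInjective l → LookupInjective (List.map f l)
map-lookupInjective {f = f} f-injective {l} l-injective {i} {j} eq = Finₚ.toℕ-injective (begin
  toℕ i                                     ≡⟨ Finₚ.toℕ-cast _ i ⟨
  toℕ (Fin.cast (Listₚ.length-map f l) i)   ≡⟨ ≡.cong toℕ (l-injective (f-injective
                                                 (≡.trans (≡.sym (lookup-map f l i)) (≡.trans eq (lookup-map f l j))))) ⟩
  toℕ (Fin.cast (Listₚ.length-map f l) j)   ≡⟨ Finₚ.toℕ-cast _ j ⟩
  toℕ j                                     ∎)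
  where open ≡.≡-Reasoning

members-lookupInjective : ∀ {n} (γ : Subset n) → LookupInjective (members γ)
members-lookupInjective (false ∷ γ) = map-lookupInjective {f = suc} Finₚ.suc-injective {members γ} (members-lookupInjective γ)
members-lookupInjective (true ∷ γ) {zero}  {zero}  _  = ≡.refl
members-lookupInjective (true ∷ γ) {zero}  {suc j} eq with ≡.trans eq (lookup-map suc (members γ) j)
... | ()
members-lookupInjective (true ∷ γ) {suc i} {zero}  eq with ≡.trans (≡.sym eq) (lookup-map suc (members γ) i)
... | ()
members-lookupInjective (true ∷ γ) {suc i} {suc j} eq =
  ≡.cong suc (map-lookupInjective {f = suc} Finₚ.suc-injective {members γ} (members-lookupInjective γ) eq)

lookup-members : ∀ {n} (γ : Subset n) i → Vec.lookup γ (List.lookup (members γ) i) ≡ true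
lookup-members (true ∷ γ) zero    = ≡.refl
lookup-members (true ∷ γ) (suc i) = ≡.trans (≡.cong (Vec.lookup (true ∷ γ)) (lookup-map suc (members γ) i)) (lookup-members γ _)
lookup-members (false ∷ γ) i      = ≡.trans (≡.cong (Vec.lookup (false ∷ γ)) (lookup-map suc (members γ) i)) (lookup-members γ _)

lookup-removeAt : ∀ {n} (γ : Subset (suc n)) j c → Vec.lookup (removeAt γ j) c ≡ Vec.lookup γ (punchIn j c)
lookup-removeAt γ j c =
  ≡.trans (≡.cong (Vec.lookup (removeAt γ j)) (≡.sym (Finₚ.punchOut-punchIn j))) (Vecₚ.removeAt-punchOut γ _)

members-removeAt : ∀ {n} (γ : Subset (suc n)) j → Vec.lookup γ j ≡ false →
                   members γ ≡ List.map (punchIn j) (members (removeAt γ j))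
members-removeAt (false ∷ γ)     zero    _  = ≡.refl
members-removeAt (true ∷ c ∷ γ)  (suc j) γj = ≡.cong (zero ∷_) (≡.trans (≡.cong (List.map suc) (members-removeAt (c ∷ γ) j γj))
  (≡.trans (≡.sym (Listₚ.map-∘ (members (removeAt (c ∷ γ) j)))) (Listₚ.map-∘ (members (removeAt (c ∷ γ) j)))))
members-removeAt (false ∷ c ∷ γ) (suc j) γj = ≡.trans (≡.cong (List.map suc) (members-removeAt (c ∷ γ) j γj))
  (≡.trans (≡.sym (Listₚ.map-∘ (members (removeAt (c ∷ γ) j)))) (Listₚ.map-∘ (members (removeAt (c ∷ γ) j))))

∣∁∣-removeAt : ∀ {n} (γ : Subset (suc n)) j → Vec.lookup γ j ≡ false → ∣ ∁ γ ∣ ≡ suc ∣ ∁ (removeAt γ j) ∣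
∣∁∣-removeAt (false ∷ γ)     zero    _  = ≡.refl
∣∁∣-removeAt (true ∷ c ∷ γ)  (suc j) γj = ∣∁∣-removeAt (c ∷ γ) j γj
∣∁∣-removeAt (false ∷ c ∷ γ) (suc j) γj = ≡.cong suc (∣∁∣-removeAt (c ∷ γ) j γj)

outside-or-⊤ : ∀ {n} (γ : Subset n) → Σ (Fin n) (λ j → Vec.lookup γ j ≡ false) ⊎ γ ≡ ⊤
outside-or-⊤ []          = inj₂ ≡.refl
outside-or-⊤ (false ∷ γ) = inj₁ (zero , ≡.refl)
outside-or-⊤ (true ∷ γ) with outside-or-⊤ γ
... | inj₁ (j , γj) = inj₁ (suc j , γj)
... | inj₂ ≡.refl   = inj₂ ≡.refl

∣∁⊤∣≡0 : ∀ n → ∣ ∁ (⊤ {n}) ∣ ≡ 0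
∣∁⊤∣≡0 n = ≡.trans (∣∁p∣≡n∸∣p∣ (⊤ {n})) (≡.trans (≡.cong (n ℕ.∸_) (∣⊤∣≡n n)) (ℕₚ.n∸n≡0 n))

∁⊥≡⊤ : ∀ n → ∁ (⊥ {n}) ≡ ⊤
∁⊥≡⊤ zero    = ≡.refl
∁⊥≡⊤ (suc n) = ≡.cong (true ∷_) (∁⊥≡⊤ n)

members-⊥ : ∀ n → members (⊥ {n}) ≡ []
members-⊥ zero    = ≡.refl
members-⊥ (suc n) = ≡.cong (List.map suc) (members-⊥ n)

length-members-⊤ : ∀ n → n ≡ List.length (members (⊤ {n}))
length-members-⊤ zero    = ≡.refl
length-members-⊤ (suc n) = ≡.cong suc (≡.trans (length-members-⊤ n) (≡.sym (Listₚ.length-map suc (members (⊤ {n})))))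

lookup-members-⊤ : ∀ n i → List.lookup (members (⊤ {n})) (Fin.cast (length-members-⊤ n) i) ≡ i
lookup-members-⊤ (suc n) zero    = ≡.refl
lookup-members-⊤ (suc n) (suc i) = begin
  List.lookup (List.map suc l) (Fin.cast _ i)
    ≡⟨ ≡.cong (List.lookup (List.map suc l)) (Finₚ.cast-trans (length-members-⊤ n) _ i) ⟨
  List.lookup (List.map suc l) (Fin.cast _ (Fin.cast (length-members-⊤ n) i))
    ≡⟨ lookup-map-cast suc l _ ⟩
  suc (List.lookup l (Fin.cast (length-members-⊤ n) i))
    ≡⟨ ≡.cong suc (lookup-members-⊤ n i) ⟩
  suc i ∎
  where
  open ≡.≡-Reasoning
  l = members (⊤ {n})

module Determinant {c ℓ} (R : CommutativeRing c ℓ) where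

  open CommutativeRing R renaming (Carrier to A) hiding (zero)
  open import Algebra.Properties.Ring ring using (-‿distribˡ-*; -‿involutive; -0#≈0#; -1*x≈-x; +-inverseʳ-unique)
  open import Algebra.Properties.Semiring.Sum semiring public
    using (sum; sum-syntax; sum-cong-≋; sum-remove; sum-replicate-zero; ∑-distrib-+; *-distribˡ-sum; *-distribʳ-sum)
  open import Algebra.Properties.Semiring.Exp semiring using (_^_)
  open import Relation.Binary.Reasoning.Setoid setoid
  open import Algebra.Solver.Ring.NaturalCoefficients.Default commutativeSemiring
    using (solve; _:=_; _:+_; _:*_)

  sum-≈0 : ∀ {n} (f : Fin n → A) → (∀ i → f i ≈ 0#) → sum f ≈ 0#
  sum-≈0 {n} f f≈0 = trans (sum-cong-≋ f≈0) (sum-replicate-zero n)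

  sum-single : ∀ {n} (f : Fin n → A) (j : Fin n) → (∀ i → i ≢ j → f i ≈ 0#) → sum f ≈ f j
  sum-single {suc n} f j others = begin
    sum f                                ≈⟨ sum-remove {i = j} f ⟩
    f j + sum (λ i → f (punchIn j i))    ≈⟨ +-congˡ (sum-≈0 _ (λ i → others _ (Finₚ.punchInᵢ≢i j i))) ⟩
    f j + 0#                             ≈⟨ +-identityʳ _ ⟩
    f j                                  ∎

  sum-pair : ∀ {n} (f : Fin n → A) {i j : Fin n} → i ≢ j →
             (∀ l → l ≢ i → l ≢ j → f l ≈ 0#) → sum f ≈ f i + f j
  sum-pair {suc n} f {i} {j} i≢j others = begin
    sum f                                ≈⟨ sum-remove {i = i} f ⟩
    f i + sum (λ l → f (punchIn i l))    ≈⟨ +-congˡ (sum-single _ j′ others′) ⟩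
    f i + f (punchIn i j′)               ≡⟨ ≡.cong (λ l → f i + f l) (Finₚ.punchIn-punchOut i≢j) ⟩
    f i + f j                            ∎
    where
    j′ = punchOut i≢j
    others′ : ∀ l → l ≢ j′ → f (punchIn i l) ≈ 0#
    others′ l l≢j′ = others _ (Finₚ.punchInᵢ≢i i l) λ eq →
      l≢j′ (Finₚ.punchIn-injective i l j′ (≡.trans eq (≡.sym (Finₚ.punchIn-punchOut i≢j))))

  δ : ∀ {n} → Fin n → Fin n → A
  δ i j = if ⌊ i ≟ j ⌋ then 1# else 0#

  δ-refl : ∀ {n} (i : Fin n) → δ i i ≡ 1#
  δ-refl = if-≟-refl

  δ-≢ : ∀ {n} {i j : Fin n} → i ≢ j → δ i j ≡ 0#
  δ-≢ = if-≟-≢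

  δ-sym : ∀ {n} (i j : Fin n) → δ i j ≡ δ j i
  δ-sym i j with i ≟ j
  ... | yes ≡.refl = ≡.sym (δ-refl i)
  ... | no i≢j     = ≡.sym (δ-≢ (i≢j ∘ ≡.sym))

  sum-δ : ∀ {n} (f : Fin n → A) (r : Fin n) → ∑[ i < n ] (f i * δ r i) ≈ f r
  sum-δ f r = begin
    ∑[ i < _ ] (f i * δ r i)  ≈⟨ sum-single _ r (λ i i≢r → trans (*-congˡ (reflexive (δ-≢ (i≢r ∘ ≡.sym)))) (zeroʳ _)) ⟩
    f r * δ r r               ≡⟨ ≡.cong (f r *_) (δ-refl r) ⟩
    f r * 1#                  ≈⟨ *-identityʳ _ ⟩
    f r                       ∎

  sign : ℕ → A
  sign zero          = 1#
  sign (suc zero)    = - 1#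
  sign (suc (suc k)) = sign k

  sign-suc : ∀ k → sign (suc k) ≈ - sign k
  sign-suc zero          = refl
  sign-suc (suc zero)    = sym (-‿involutive 1#)
  sign-suc (suc (suc k)) = sign-suc k

  sign-+ : ∀ k l → sign (k ℕ.+ l) ≈ sign k * sign l
  sign-+ zero          l = sym (*-identityˡ _)
  sign-+ (suc zero)    l = trans (sign-suc l) (sym (-1*x≈-x (sign l)))
  sign-+ (suc (suc k)) l = sign-+ k l

  sign-double : ∀ k → sign (k ℕ.+ k) ≈ 1#
  sign-double zero    = refl
  sign-double (suc k) = trans (reflexive (≡.cong (sign ∘ suc) (ℕₚ.+-suc k k))) (sign-double k)

  Mat : ℕ → Set c
  Mat n = Fin n → Fin n → A

  infix 4 _≋_
  _≋_ : ∀ {n} → Mat n → Mat n → Set ℓ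
  M ≋ N = ∀ r c → M r c ≈ N r c

  _ᵀ : ∀ {n} → Mat n → Mat n
  (M ᵀ) r c = M c r

  infixl 7 _·_
  _·_ : ∀ {n} → Mat n → Mat n → Mat n
  (N · M) r c = ∑[ l < _ ] (N r l * M l c)

  minor : ∀ {n} → Fin (suc n) → Fin (suc n) → Mat (suc n) → Mat n
  minor i j M r c = M (punchIn i r) (punchIn j c)

  det : (n : ℕ) → Mat n → A
  laplaceTerm : (n : ℕ) → Mat (suc n) → Fin (suc n) → A

  det zero    M = 1#
  det (suc n) M = sum (laplaceTerm n M)

  laplaceTerm n M j = sign (toℕ j) * M zero j * det n (minor zero j M)

  det-cong : ∀ n {M N : Mat n} → M ≋ N → det n M ≈ det n N
  det-cong zero    M≋N = refl
  det-cong (suc n) {M} {N} M≋N = sum-cong-≋ term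
    where
    term : ∀ j → laplaceTerm n M j ≈ laplaceTerm n N j
    term j = *-cong (*-congˡ (M≋N zero j)) (det-cong n (λ r c → M≋N (suc r) (punchIn j c)))

  setCol : ∀ {n} → Mat n → Fin n → (Fin n → A) → Mat n
  setCol M j v r c = if ⌊ c ≟ j ⌋ then v r else M r c

  setCol-at : ∀ {n} (M : Mat n) j v r → setCol M j v r j ≡ v r
  setCol-at M j v r = if-≟-refl j

  setCol-other : ∀ {n} (M : Mat n) {j} v r {c} → c ≢ j → setCol M j v r c ≡ M r c
  setCol-other M v r = if-≟-≢

  setCol-cong : ∀ {n} (M : Mat n) j {u v : Fin n → A} → (∀ r → u r ≈ v r) → setCol M j u ≋ setCol M j v
  setCol-cong M j {u} {v} u≈v r c with c ≟ j
  ... | yes _ = u≈v r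
  ... | no _  = refl

  setCol-self : ∀ {n} (M : Mat n) j → setCol M j (λ r → M r j) ≋ M
  setCol-self M j r c with c ≟ j
  ... | yes ≡.refl = refl
  ... | no _       = refl

  laplaceTerm-setCol-at : ∀ n (M : Mat (suc n)) j v →
    laplaceTerm n (setCol M j v) j ≈ sign (toℕ j) * v zero * det n (minor zero j M)
  laplaceTerm-setCol-at n M j v =
    *-cong (*-congˡ (reflexive (setCol-at M j v zero)))
           (det-cong n λ r c → reflexive (setCol-other M v (suc r) (Finₚ.punchInᵢ≢i j c)))

  laplaceTerm-setCol-other : ∀ n (M : Mat (suc n)) {j l} v (l≢j : l ≢ j) →
    laplaceTerm n (setCol M j v) l
      ≈ sign (toℕ l) * M zero l * det n (setCol (minor zero l M) (punchOut l≢j) (v ∘ suc))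
  laplaceTerm-setCol-other n M {j} {l} v l≢j =
    *-cong (*-congˡ (reflexive (setCol-other M v zero l≢j)))
           (det-cong n λ r c → reflexive (≡.trans
             (≡.cong (λ j → if ⌊ punchIn l c ≟ j ⌋ then v (suc r) else M (suc r) (punchIn l c))
                     (≡.sym (Finₚ.punchIn-punchOut l≢j)))
             (if-≟-punchIn l c _)))

  det-linear : ∀ n (M : Mat n) j a (u v : Fin n → A) →
    det n (setCol M j (λ r → a * u r + v r)) ≈ a * det n (setCol M j u) + det n (setCol M j v)
  det-linear (suc n) M j a u v = begin
    sum (laplaceTerm n (setCol M j w))
      ≈⟨ sum-cong-≋ term ⟩
    ∑[ l < suc n ] (a * laplaceTerm n (setCol M j u) l + laplaceTerm n (setCol M j v) l)
      ≈⟨ ∑-distrib-+ (λ l → a * laplaceTerm n (setCol M j u) l) (laplaceTerm n (setCol M j v)) ⟩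
    ∑[ l < suc n ] (a * laplaceTerm n (setCol M j u) l) + det (suc n) (setCol M j v)
      ≈⟨ +-congʳ (sym (*-distribˡ-sum a (laplaceTerm n (setCol M j u)))) ⟩
    a * det (suc n) (setCol M j u) + det (suc n) (setCol M j v) ∎
    where
    w = λ r → a * u r + v r
    term : ∀ l → laplaceTerm n (setCol M j w) l
               ≈ a * laplaceTerm n (setCol M j u) l + laplaceTerm n (setCol M j v) l
    term l with toSum (l ≟ j)
    ... | inj₁ ≡.refl = begin
      laplaceTerm n (setCol M l w) l
        ≈⟨ laplaceTerm-setCol-at n M l w ⟩
      sign (toℕ l) * (a * u zero + v zero) * det n (minor zero l M)
        ≈⟨ solve 5 (λ s a u v d → s :* (a :* u :+ v) :* d := a :* (s :* u :* d) :+ s :* v :* d)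
                 refl (sign (toℕ l)) a (u zero) (v zero) (det n (minor zero l M)) ⟩
      a * (sign (toℕ l) * u zero * det n (minor zero l M)) + sign (toℕ l) * v zero * det n (minor zero l M)
        ≈⟨ sym (+-cong (*-congˡ (laplaceTerm-setCol-at n M l u)) (laplaceTerm-setCol-at n M l v)) ⟩
      a * laplaceTerm n (setCol M l u) l + laplaceTerm n (setCol M l v) l ∎
    ... | inj₂ l≢j = begin
      laplaceTerm n (setCol M j w) l
        ≈⟨ laplaceTerm-setCol-other n M w l≢j ⟩
      s * m * det n (setCol N j′ (λ r → a * u (suc r) + v (suc r)))
        ≈⟨ *-congˡ (det-linear n N j′ a (u ∘ suc) (v ∘ suc)) ⟩
      s * m * (a * det n (setCol N j′ (u ∘ suc)) + det n (setCol N j′ (v ∘ suc)))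
        ≈⟨ solve 5 (λ s m a x y → s :* m :* (a :* x :+ y) := a :* (s :* m :* x) :+ s :* m :* y)
                 refl s m a (det n (setCol N j′ (u ∘ suc))) (det n (setCol N j′ (v ∘ suc))) ⟩
      a * (s * m * det n (setCol N j′ (u ∘ suc))) + s * m * det n (setCol N j′ (v ∘ suc))
        ≈⟨ sym (+-cong (*-congˡ (laplaceTerm-setCol-other n M u l≢j)) (laplaceTerm-setCol-other n M v l≢j)) ⟩
      a * laplaceTerm n (setCol M j u) l + laplaceTerm n (setCol M j v) l ∎
      where
      s = sign (toℕ l)
      m = M zero l
      N = minor zero l M
      j′ = punchOut l≢j

  record IsMultilinear (n : ℕ) (D : Mat n → A) : Set (c ⊔ ℓ) where
    field
      D-cong   : ∀ {M N} → M ≋ N → D M ≈ D N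
      D-linear : ∀ M j a (u v : Fin n → A) →
                 D (setCol M j (λ r → a * u r + v r)) ≈ a * D (setCol M j u) + D (setCol M j v)

  IsAlternating : (n : ℕ) → (Mat n → A) → Set (c ⊔ ℓ)
  IsAlternating n D = ∀ M {i j : Fin n} → i ≢ j → (∀ r → M r i ≈ M r j) → D M ≈ 0#

  det-multilinear : ∀ n → IsMultilinear n (det n)
  det-multilinear n = record { D-cong = det-cong n ; D-linear = det-linear n }

  swapCols : ∀ {n} → Fin n → Fin n → Mat n → Mat n
  swapCols p q M r c = M r (transpose p q c)

  setCol-comm : ∀ {n} (M : Mat n) {p q} → p ≢ q → ∀ a b →
                setCol (setCol M p a) q b ≋ setCol (setCol M q b) p a
  setCol-comm M {p} {q} p≢q a b r c with c ≟ q | c ≟ p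
  ... | yes ≡.refl | yes c≡p = ⊥-elim (p≢q (≡.sym c≡p))
  ... | yes _      | no _    = refl
  ... | no _       | yes _   = refl
  ... | no _       | no _    = refl

  module Multilinear {n} {D : Mat n → A} (L : IsMultilinear n D) where
    open IsMultilinear L public

    D-zeroCol : ∀ M j → (∀ r → M r j ≈ 0#) → D M ≈ 0#
    D-zeroCol M j Mj≈0 = begin
      D M                                               ≈⟨ D-cong (λ r c → sym (setCol-self M j r c)) ⟩
      D (setCol M j (λ r → M r j))                      ≈⟨ D-cong (setCol-cong M j λ r → trans (Mj≈0 r) (sym (-1*x+x≈0 0#))) ⟩
      D (setCol M j (λ _ → - 1# * 0# + 0#))             ≈⟨ D-linear M j (- 1#) (λ _ → 0#) (λ _ → 0#) ⟩
      - 1# * D (setCol M j (λ _ → 0#)) + D (setCol M j (λ _ → 0#)) ≈⟨ -1*x+x≈0 _ ⟩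
      0#                                                ∎
      where
      -1*x+x≈0 : ∀ x → - 1# * x + x ≈ 0#
      -1*x+x≈0 x = trans (+-congʳ (-1*x≈-x x)) (-‿inverseˡ x)

    D-add : ∀ M j (u v : Fin n → A) → D (setCol M j (λ r → u r + v r)) ≈ D (setCol M j u) + D (setCol M j v)
    D-add M j u v = begin
      D (setCol M j (λ r → u r + v r))               ≈⟨ D-cong (setCol-cong M j λ r → +-congʳ (sym (*-identityˡ (u r)))) ⟩
      D (setCol M j (λ r → 1# * u r + v r))          ≈⟨ D-linear M j 1# u v ⟩
      1# * D (setCol M j u) + D (setCol M j v)       ≈⟨ +-congʳ (*-identityˡ _) ⟩
      D (setCol M j u) + D (setCol M j v)            ∎

    D-linear-sum : ∀ {m} M j (a : Fin m → A) (u : Fin m → Fin n → A) →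
                   D (setCol M j (λ r → ∑[ i < m ] (a i * u i r))) ≈ ∑[ i < m ] (a i * D (setCol M j (u i)))
    D-linear-sum {zero}  M j a u = D-zeroCol _ j (λ r → reflexive (setCol-at M j _ r))
    D-linear-sum {suc m} M j a u = begin
      D (setCol M j (λ r → a zero * u zero r + ∑[ i < m ] (a (suc i) * u (suc i) r)))
        ≈⟨ D-linear M j (a zero) (u zero) _ ⟩
      a zero * D (setCol M j (u zero)) + D (setCol M j (λ r → ∑[ i < m ] (a (suc i) * u (suc i) r)))
        ≈⟨ +-congˡ (D-linear-sum M j (a ∘ suc) (u ∘ suc)) ⟩
      a zero * D (setCol M j (u zero)) + ∑[ i < m ] (a (suc i) * D (setCol M j (u (suc i)))) ∎

    swapCols-negates : ∀ {p q} → p ≢ q → (∀ N → (∀ r → N r p ≈ N r q) → D N ≈ 0#) →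
                       ∀ M → D (swapCols p q M) ≈ - D M
    swapCols-negates {p} {q} p≢q alt M = +-inverseʳ-unique (D M) (D (swapCols p q M)) (begin
      D M + D (swapCols p q M)         ≈⟨ +-cong (D-cong M≋Buv) (D-cong swap≋Bvu) ⟩
      B u v + B v u                    ≈⟨ +-cong (+-identityˡ _) (+-identityʳ _) ⟨
      (0# + B u v) + (B v u + 0#)      ≈⟨ +-cong (+-congʳ (B-diag u)) (+-congˡ (B-diag v)) ⟨
      (B u u + B u v) + (B v u + B v v) ≈⟨ +-cong (B-addʳ u u v) (B-addʳ v u v) ⟨
      B u w + B v w                    ≈⟨ B-addˡ u v w ⟨
      B w w                            ≈⟨ B-diag w ⟩
      0#                               ∎)
      where
      B : (Fin n → A) → (Fin n → A) → A
      B a b = D (setCol (setCol M p a) q b)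
      u = λ r → M r p
      v = λ r → M r q
      w = λ r → u r + v r
      B-diag : ∀ a → B a a ≈ 0#
      B-diag a = alt _ λ r → begin
        setCol (setCol M p a) q a r p ≡⟨ setCol-other (setCol M p a) a r p≢q ⟩
        setCol M p a r p              ≡⟨ setCol-at M p a r ⟩
        a r                           ≡⟨ setCol-at (setCol M p a) q a r ⟨
        setCol (setCol M p a) q a r q ∎
      B-addʳ : ∀ a b b′ → B a (λ r → b r + b′ r) ≈ B a b + B a b′
      B-addʳ a = D-add (setCol M p a) q
      B-addˡ : ∀ a a′ b → B (λ r → a r + a′ r) b ≈ B a b + B a′ b
      B-addˡ a a′ b = begin
        B (λ r → a r + a′ r) b                 ≈⟨ D-cong (setCol-comm M p≢q _ b) ⟩
        D (setCol (setCol M q b) p (λ r → a r + a′ r)) ≈⟨ D-add (setCol M q b) p a a′ ⟩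
        D (setCol (setCol M q b) p a) + D (setCol (setCol M q b) p a′)
          ≈⟨ +-cong (D-cong (setCol-comm M p≢q a b)) (D-cong (setCol-comm M p≢q a′ b)) ⟨
        B a b + B a′ b                         ∎
      M≋Buv : M ≋ setCol (setCol M p u) q v
      M≋Buv r c with c ≟ q | c ≟ p
      ... | yes ≡.refl | _          = refl
      ... | no _       | yes ≡.refl = refl
      ... | no _       | no _       = refl
      swap≋Bvu : swapCols p q M ≋ setCol (setCol M p v) q u
      swap≋Bvu r c with toSum (c ≟ q) | toSum (c ≟ p)
      ... | inj₁ ≡.refl | _ = reflexive (≡.trans (≡.cong (M r) (transpose-right p≢q)) (≡.sym (setCol-at (setCol M p v) c u r)))
      ... | inj₂ c≢q    | inj₁ ≡.refl = reflexive (≡.trans (≡.cong (M r) (transpose-left c q))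
                                          (≡.sym (≡.trans (setCol-other (setCol M p v) u r c≢q) (setCol-at M c v r))))
      ... | inj₂ c≢q    | inj₂ c≢p    = reflexive (≡.trans (≡.cong (M r) (transpose-other c≢p c≢q))
                                          (≡.sym (≡.trans (setCol-other (setCol M p v) u r c≢q) (setCol-other M v r c≢p))))

    module _ (alt-adj : ∀ M {i j} → Adjacent i j → (∀ r → M r i ≈ M r j) → D M ≈ 0#) where

      alternating-at-distance : ∀ d M {i j} → toℕ j ≡ suc (d ℕ.+ toℕ i) → (∀ r → M r i ≈ M r j) → D M ≈ 0#
      alternating-at-distance zero    M ij Mi≈Mj = alt-adj M ij Mi≈Mj
      alternating-at-distance (suc d) M {i} {j} ij Mi≈Mj = begin
        D M                         ≈⟨ -‿involutive (D M) ⟨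
        - - D M                     ≈⟨ -‿cong (swapCols-negates (adjacent⇒≢ kj) (λ N → alt-adj N kj) M) ⟨
        - D (swapCols k j M)        ≈⟨ -‿cong (alternating-at-distance d (swapCols k j M) ik Ni≈Nk) ⟩
        - 0#                        ≈⟨ -0#≈0# ⟩
        0#                          ∎
        where
        k  = proj₁ (predecessor ij)
        kj = proj₂ (predecessor ij)
        ik : toℕ k ≡ suc (d ℕ.+ toℕ i)
        ik = ℕₚ.suc-injective (≡.trans (≡.sym kj) ij)
        i≢k : i ≢ k
        i≢k i≡k = ℕₚ.m≢1+n+m (toℕ i) (≡.trans (≡.cong toℕ i≡k) ik)
        i≢j : i ≢ j
        i≢j i≡j = ℕₚ.m≢1+n+m (toℕ i) {suc d} (≡.trans (≡.cong toℕ i≡j) ij)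
        Ni≈Nk : ∀ r → swapCols k j M r i ≈ swapCols k j M r k
        Ni≈Nk r = begin
          M r (transpose k j i) ≡⟨ ≡.cong (M r) (transpose-other i≢k i≢j) ⟩
          M r i                 ≈⟨ Mi≈Mj r ⟩
          M r j                 ≡⟨ ≡.cong (M r) (transpose-left k j) ⟨
          M r (transpose k j k) ∎

      adjacent⇒alternating : IsAlternating n D
      adjacent⇒alternating M {i} {j} i≢j Mi≈Mj with ℕₚ.<-cmp (toℕ i) (toℕ j)
      ... | tri< i<j _ _ = alternating-at-distance _ M (<⇒suc-distance i<j) Mi≈Mj
      ... | tri≈ _ i≡j _ = ⊥-elim (i≢j (Finₚ.toℕ-injective i≡j))
      ... | tri> _ _ j<i = alternating-at-distance _ M (<⇒suc-distance j<i) (sym ∘ Mi≈Mj)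

  -- Laplace expansion along the first row only sees equal adjacent columns; transpositions do the rest.
  det-adjacent-alternating : ∀ n M {i j : Fin n} → Adjacent i j → (∀ r → M r i ≈ M r j) → det n M ≈ 0#
  det-adjacent-alternating (suc n) M {i} {j} ij Mi≈Mj = begin
    det (suc n) M                            ≈⟨ sum-pair (laplaceTerm n M) (adjacent⇒≢ ij) others ⟩
    laplaceTerm n M i + laplaceTerm n M j    ≈⟨ +-congˡ term-j ⟩
    laplaceTerm n M i + - laplaceTerm n M i  ≈⟨ -‿inverseʳ _ ⟩
    0#                                       ∎
    where
    others : ∀ l → l ≢ i → l ≢ j → laplaceTerm n M l ≈ 0#
    others l l≢i l≢j = trans (*-congˡ (det-adjacent-alternating n (minor zero l M) ij′ Mi′≈Mj′)) (zeroʳ _)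
      where
      ij′ : Adjacent (punchOut l≢i) (punchOut l≢j)
      ij′ = punchIn-adjacent⁻¹ l (≡.subst₂ Adjacent (≡.sym (Finₚ.punchIn-punchOut l≢i))
                                                     (≡.sym (Finₚ.punchIn-punchOut l≢j)) ij)
      Mi′≈Mj′ : ∀ r → minor zero l M r (punchOut l≢i) ≈ minor zero l M r (punchOut l≢j)
      Mi′≈Mj′ r = begin
        M (suc r) (punchIn l (punchOut l≢i))  ≡⟨ ≡.cong (M (suc r)) (Finₚ.punchIn-punchOut l≢i) ⟩
        M (suc r) i                           ≈⟨ Mi≈Mj (suc r) ⟩
        M (suc r) j                           ≡⟨ ≡.cong (M (suc r)) (Finₚ.punchIn-punchOut l≢j) ⟨
        M (suc r) (punchIn l (punchOut l≢j))  ∎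
    minor-j≋minor-i : minor zero j M ≋ minor zero i M
    minor-j≋minor-i r c with punchIn-adjacent ij c
    ... | inj₁ eq         = reflexive (≡.cong (M (suc r)) eq)
    ... | inj₂ (eq , eq′) = begin
      M (suc r) (punchIn j c)  ≡⟨ ≡.cong (M (suc r)) eq ⟩
      M (suc r) i              ≈⟨ Mi≈Mj (suc r) ⟩
      M (suc r) j              ≡⟨ ≡.cong (M (suc r)) eq′ ⟨
      M (suc r) (punchIn i c)  ∎
    term-j : laplaceTerm n M j ≈ - laplaceTerm n M i
    term-j = begin
      sign (toℕ j) * M zero j * det n (minor zero j M)
        ≈⟨ *-cong (*-cong (trans (reflexive (≡.cong sign ij)) (sign-suc (toℕ i))) (sym (Mi≈Mj zero)))
                  (det-cong n minor-j≋minor-i) ⟩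
      - sign (toℕ i) * M zero i * det n (minor zero i M)
        ≈⟨ *-congʳ (-‿distribˡ-* _ _) ⟨
      - (sign (toℕ i) * M zero i) * det n (minor zero i M)
        ≈⟨ -‿distribˡ-* _ _ ⟨
      - laplaceTerm n M i ∎

  det-alternating : ∀ n → IsAlternating n (det n)
  det-alternating n = Multilinear.adjacent⇒alternating (det-multilinear n) (det-adjacent-alternating n)

  embed : ∀ {n} → Fin (suc n) → Mat n → Mat (suc n)
  embed i N r zero    = δ r i
  embed i N r (suc c) = insertAt (λ r′ → N r′ c) i 0# r

  insertAt-linear : ∀ {n} (i : Fin (suc n)) a (u v : Fin n → A) r →
    insertAt (λ x → a * u x + v x) i 0# r ≈ a * insertAt u i 0# r + insertAt v i 0# r
  insertAt-linear i a u v r with punchIn-view i r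
  ... | inj₁ ≡.refl = begin
    insertAt (λ x → a * u x + v x) r 0# r          ≡⟨ insertAt-at _ r 0# ⟩
    0#                                             ≈⟨ trans (+-congʳ (zeroʳ a)) (+-identityˡ 0#) ⟨
    a * 0# + 0#                                    ≡⟨ ≡.cong₂ (λ x y → a * x + y) (insertAt-at u r 0#) (insertAt-at v r 0#) ⟨
    a * insertAt u r 0# r + insertAt v r 0# r      ∎
  ... | inj₂ (r′ , ≡.refl) = reflexive (≡.trans (insertAt-punchIn _ i 0# r′)
    (≡.sym (≡.cong₂ (λ x y → a * x + y) (insertAt-punchIn u i 0# r′) (insertAt-punchIn v i 0# r′))))

  insertAt-cong : ∀ {n} (i : Fin (suc n)) {u v : Fin n → A} → (∀ x → u x ≈ v x) →
                  ∀ r → insertAt u i 0# r ≈ insertAt v i 0# r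
  insertAt-cong i {u} {v} u≈v r with punchIn-view i r
  ... | inj₁ ≡.refl = reflexive (≡.trans (insertAt-at u r 0#) (≡.sym (insertAt-at v r 0#)))
  ... | inj₂ (r′ , ≡.refl) = begin
    insertAt u i 0# (punchIn i r′)  ≡⟨ insertAt-punchIn u i 0# r′ ⟩
    u r′                            ≈⟨ u≈v r′ ⟩
    v r′                            ≡⟨ insertAt-punchIn v i 0# r′ ⟨
    insertAt v i 0# (punchIn i r′)  ∎

  embed-cong : ∀ {n} (i : Fin (suc n)) {N N′ : Mat n} → N ≋ N′ → embed i N ≋ embed i N′
  embed-cong i N≋N′ r zero    = refl
  embed-cong i N≋N′ r (suc c) = insertAt-cong i (λ x → N≋N′ x c) r

  embed-setCol : ∀ {n} (i : Fin (suc n)) (N : Mat n) j v →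
                 embed i (setCol N j v) ≋ setCol (embed i N) (suc j) (λ r → insertAt v i 0# r)
  embed-setCol i N j v r zero    = refl
  embed-setCol i N j v r (suc c) with c ≟ j
  ... | yes _ = refl
  ... | no _  = refl

  embed-multilinear : ∀ {n} {D : Mat (suc n) → A} → IsMultilinear (suc n) D →
                      (i : Fin (suc n)) → IsMultilinear n (D ∘ embed i)
  embed-multilinear {n} {D} L i = record
    { D-cong   = D-cong ∘ embed-cong i
    ; D-linear = linear
    }
    where
    open Multilinear L
    ins : (Fin n → A) → Fin (suc n) → A
    ins u r = insertAt u i 0# r
    linear : ∀ N j a (u v : Fin n → A) →
             D (embed i (setCol N j (λ r → a * u r + v r))) ≈ a * D (embed i (setCol N j u)) + D (embed i (setCol N j v))
    linear N j a u v = begin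
      D (embed i (setCol N j (λ r → a * u r + v r)))     ≈⟨ D-cong (embed-setCol i N j _) ⟩
      D (setCol (embed i N) (suc j) (ins (λ r → a * u r + v r)))
        ≈⟨ D-cong (setCol-cong (embed i N) (suc j) (insertAt-linear i a u v)) ⟩
      D (setCol (embed i N) (suc j) (λ r → a * ins u r + ins v r))
        ≈⟨ D-linear (embed i N) (suc j) a (ins u) (ins v) ⟩
      a * D (setCol (embed i N) (suc j) (ins u)) + D (setCol (embed i N) (suc j) (ins v))
        ≈⟨ +-cong (*-congˡ (D-cong (embed-setCol i N j u))) (D-cong (embed-setCol i N j v)) ⟨
      a * D (embed i (setCol N j u)) + D (embed i (setCol N j v)) ∎

  embed-alternating : ∀ {n} {D : Mat (suc n) → A} → IsAlternating (suc n) D →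
                      (i : Fin (suc n)) → IsAlternating n (D ∘ embed i)
  embed-alternating alt i N a≢b Na≈Nb =
    alt (embed i N) (a≢b ∘ Finₚ.suc-injective) (insertAt-cong i Na≈Nb)

  embed-δ : ∀ {n} (i : Fin (suc n)) → embed i δ ≋ λ r c → δ r (cycle i c)
  embed-δ i r zero    = refl
  embed-δ i r (suc c) with punchIn-view i r
  ... | inj₁ ≡.refl = reflexive (≡.trans (insertAt-at _ r 0#) (≡.sym (δ-≢ (Finₚ.punchInᵢ≢i r c ∘ ≡.sym))))
  ... | inj₂ (r′ , ≡.refl) = reflexive (≡.trans (insertAt-punchIn _ i 0# r′) (≡.sym (if-≟-punchIn i r′ c)))

  module AlternatingForm {n} {D : Mat (suc n) → A} (L : IsMultilinear (suc n) D) (alt : IsAlternating (suc n) D) where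
    open Multilinear L

    expand-first-col : ∀ M → D M ≈ ∑[ i < suc n ] (M i zero * D (setCol M zero (λ r → δ r i)))
    expand-first-col M = begin
      D M                                                           ≈⟨ D-cong (setCol-self M zero) ⟨
      D (setCol M zero (λ r → M r zero))                            ≈⟨ D-cong (setCol-cong M zero λ r → sym (sum-δ (λ i → M i zero) r)) ⟩
      D (setCol M zero (λ r → ∑[ i < suc n ] (M i zero * δ r i)))  ≈⟨ D-linear-sum M zero (λ i → M i zero) (λ i r → δ r i) ⟩
      ∑[ i < suc n ] (M i zero * D (setCol M zero (λ r → δ r i)))  ∎

    module _ (i : Fin (suc n)) where

      -- If the first column is eᵢ, adding a multiple of it to another column leaves D unchanged and
      -- modifies that column only in row i; so row i can be cleared outside the first column.
      clear-entry : ∀ X c (v : Fin (suc n) → A) → c ≢ zero → (∀ r → X r zero ≈ δ r i) →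
                    (∀ r → r ≢ i → v r ≈ X r c) → D X ≈ D (setCol X c v)
      clear-entry X c v c≢0 X₀≈eᵢ v≈Xc = sym (begin
        D (setCol X c v)                                       ≈⟨ D-cong (setCol-cong X c v≈aX₀+Xc) ⟩
        D (setCol X c (λ r → a * X r zero + X r c))            ≈⟨ D-linear X c a (λ r → X r zero) (λ r → X r c) ⟩
        a * D (setCol X c (λ r → X r zero)) + D (setCol X c (λ r → X r c))
          ≈⟨ +-cong (*-congˡ (alt (setCol X c X₀) c≢0 λ r →
                      reflexive (≡.trans (setCol-at X c X₀ r) (≡.sym (setCol-other X X₀ r (c≢0 ∘ ≡.sym))))))
                    (D-cong (setCol-self X c)) ⟩
        a * 0# + D X                                           ≈⟨ trans (+-congʳ (zeroʳ a)) (+-identityˡ _) ⟩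
        D X                                                    ∎)
        where
        X₀ = λ r → X r zero
        a = v i - X i c
        v≈aX₀+Xc : ∀ r → v r ≈ a * X r zero + X r c
        v≈aX₀+Xc r with toSum (r ≟ i)
        ... | inj₁ ≡.refl = sym (begin
          a * X r zero + X r c    ≈⟨ +-congʳ (*-congˡ (trans (X₀≈eᵢ r) (reflexive (δ-refl r)))) ⟩
          a * 1# + X r c          ≈⟨ +-congʳ (*-identityʳ a) ⟩
          (v r - X r c) + X r c   ≈⟨ +-assoc _ _ _ ⟩
          v r + (- X r c + X r c) ≈⟨ +-congˡ (-‿inverseˡ _) ⟩
          v r + 0#                ≈⟨ +-identityʳ _ ⟩
          v r                     ∎)
        ... | inj₂ r≢i = begin
          v r                     ≈⟨ v≈Xc r r≢i ⟩
          X r c                   ≈⟨ +-identityˡ _ ⟨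
          0# + X r c              ≈⟨ +-congʳ (trans (*-congˡ (trans (X₀≈eᵢ r) (reflexive (δ-≢ r≢i)))) (zeroʳ a)) ⟨
          a * X r zero + X r c    ∎

      AgreeBeyond : ℕ → Mat (suc n) → Mat (suc n) → Set ℓ
      AgreeBeyond k X Y = ∀ r c → r ≢ i ⊎ (c ≡ zero ⊎ k ℕ.< toℕ c) → X r c ≈ Y r c

      clear-upto : ∀ k → k ℕ.≤ n → ∀ X Y → (∀ r → X r zero ≈ δ r i) → AgreeBeyond k X Y → D X ≈ D Y
      clear-upto zero _ X Y _ X≈Y = D-cong λ r c → X≈Y r c (everywhere c)
        where
        everywhere : ∀ {r} c → r ≢ i ⊎ (c ≡ zero ⊎ 0 ℕ.< toℕ c)
        everywhere zero    = inj₂ (inj₁ ≡.refl)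
        everywhere (suc c) = inj₂ (inj₂ (ℕ.s≤s ℕ.z≤n))
      clear-upto (suc k) k<n X Y X₀≈eᵢ X≈Y =
        trans (clear-entry X cₖ (λ r → Y r cₖ) cₖ≢0 X₀≈eᵢ (λ r r≢i → sym (X≈Y r cₖ (inj₁ r≢i))))
              (clear-upto k (ℕₚ.<⇒≤ k<n) X′ Y X′₀≈eᵢ X′≈Y)
        where
        cₖ : Fin (suc n)
        cₖ = Fin.fromℕ< (ℕ.s≤s k<n)
        toℕcₖ : toℕ cₖ ≡ suc k
        toℕcₖ = Finₚ.toℕ-fromℕ< (ℕ.s≤s k<n)
        cₖ≢0 : cₖ ≢ zero
        cₖ≢0 cₖ≡0 = ℕₚ.1+n≢0 (≡.trans (≡.sym toℕcₖ) (≡.cong toℕ cₖ≡0))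
        Yₖ = λ r → Y r cₖ
        X′ = setCol X cₖ Yₖ
        X′₀≈eᵢ : ∀ r → X′ r zero ≈ δ r i
        X′₀≈eᵢ r = trans (reflexive (setCol-other X Yₖ r (cₖ≢0 ∘ ≡.sym))) (X₀≈eᵢ r)
        X′≈Y : AgreeBeyond k X′ Y
        X′≈Y r c agree with toSum (c ≟ cₖ)
        ... | inj₁ ≡.refl = reflexive (setCol-at X c Yₖ r)
        ... | inj₂ c≢cₖ   = trans (reflexive (setCol-other X Yₖ r c≢cₖ)) (X≈Y r c (widen agree))
          where
          widen : r ≢ i ⊎ (c ≡ zero ⊎ k ℕ.< toℕ c) → r ≢ i ⊎ (c ≡ zero ⊎ suc k ℕ.< toℕ c)
          widen (inj₁ r≢i)         = inj₁ r≢i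
          widen (inj₂ (inj₁ c≡0))  = inj₂ (inj₁ c≡0)
          widen (inj₂ (inj₂ k<c))  = inj₂ (inj₂ (ℕₚ.≤∧≢⇒< k<c λ eq → c≢cₖ (Finₚ.toℕ-injective (≡.trans (≡.sym eq) (≡.sym toℕcₖ)))))

      clear-row : ∀ M → D (setCol M zero (λ r → δ r i)) ≈ D (embed i (minor i zero M))
      clear-row M = clear-upto n ℕₚ.≤-refl _ _ (λ r → refl) agree
        where
        agree : AgreeBeyond n (setCol M zero (λ r → δ r i)) (embed i (minor i zero M))
        agree r zero    _                     = refl
        agree r (suc c) (inj₂ (inj₂ n<c))     = ⊥-elim (ℕₚ.<-irrefl ≡.refl (ℕₚ.<-≤-trans n<c (ℕₚ.≤-pred (Finₚ.toℕ<n (suc c)))))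
        agree r (suc c) (inj₁ r≢i) with punchIn-view i r
        ... | inj₁ r≡i          = ⊥-elim (r≢i r≡i)
        ... | inj₂ (r′ , ≡.refl) = reflexive (≡.sym (insertAt-punchIn _ i 0# r′))

    D-cycle : ∀ k (i : Fin (suc n)) → toℕ i ≡ k → D (λ r c → δ r (cycle i c)) ≈ sign k * D δ
    D-cycle zero zero _ = trans (D-cong cycle-zero) (sym (*-identityˡ _))
      where
      cycle-zero : (λ r c → δ r (cycle zero c)) ≋ δ
      cycle-zero r zero    = refl
      cycle-zero r (suc c) = refl
    D-cycle (suc k) (suc i) i≡k = begin
      D (λ r c → δ r (cycle (suc i) c))
        ≈⟨ D-cong (λ r c → reflexive (≡.cong (δ r) (cycle-suc i c))) ⟩
      D (swapCols zero (suc i) (λ r c → δ r (cycle (inject₁ i) c)))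
        ≈⟨ swapCols-negates (λ ()) (λ N → alt N (λ ())) _ ⟩
      - D (λ r c → δ r (cycle (inject₁ i) c))
        ≈⟨ -‿cong (D-cycle k (inject₁ i) (≡.trans (Finₚ.toℕ-inject₁ i) (ℕₚ.suc-injective i≡k))) ⟩
      - (sign k * D δ)                 ≈⟨ -‿distribˡ-* _ _ ⟩
      - sign k * D δ                   ≈⟨ *-congʳ (sign-suc k) ⟨
      sign (suc k) * D δ               ∎

  alternatingForm≈det : ∀ n {D : Mat n → A} → IsMultilinear n D → IsAlternating n D →
                        ∀ M → D M ≈ det n (M ᵀ) * D δ
  alternatingForm≈det zero    L alt M = trans (IsMultilinear.D-cong L λ ()) (sym (*-identityˡ _))
  alternatingForm≈det (suc n) {D} L alt M = begin
    D M                                                  ≈⟨ expand-first-col M ⟩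
    ∑[ i < suc n ] (M i zero * D (setCol M zero (λ r → δ r i))) ≈⟨ sum-cong-≋ term ⟩
    ∑[ i < suc n ] (laplaceTerm n (M ᵀ) i * D δ)        ≈⟨ *-distribʳ-sum (D δ) (laplaceTerm n (M ᵀ)) ⟨
    det (suc n) (M ᵀ) * D δ                              ∎
    where
    open IsMultilinear L
    open AlternatingForm L alt
    term : ∀ i → M i zero * D (setCol M zero (λ r → δ r i)) ≈ laplaceTerm n (M ᵀ) i * D δ
    term i = begin
      M i zero * D (setCol M zero (λ r → δ r i))
        ≈⟨ *-congˡ (clear-row i M) ⟩
      M i zero * D (embed i (minor i zero M))
        ≈⟨ *-congˡ (alternatingForm≈det n (embed-multilinear L i) (embed-alternating alt i) (minor i zero M)) ⟩
      M i zero * (det n (minor zero i (M ᵀ)) * D (embed i δ))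
        ≈⟨ *-congˡ (*-congˡ (trans (D-cong (embed-δ i)) (D-cycle (toℕ i) i ≡.refl))) ⟩
      M i zero * (det n (minor zero i (M ᵀ)) * (sign (toℕ i) * D δ))
        ≈⟨ solve 4 (λ m d s x → m :* (d :* (s :* x)) := s :* m :* d :* x) refl _ _ _ _ ⟩
      laplaceTerm n (M ᵀ) i * D δ ∎

  det-δ : ∀ n → det n δ ≈ 1#
  det-δ zero    = refl
  det-δ (suc n) = begin
    det (suc n) δ                    ≈⟨ sum-single (laplaceTerm n δ) zero off-diagonal ⟩
    1# * 1# * det n (minor zero zero δ) ≈⟨ *-congˡ (det-cong n λ r c → reflexive (if-≟-punchIn zero r c)) ⟩
    1# * 1# * det n δ                ≈⟨ *-congˡ (det-δ n) ⟩
    1# * 1# * 1#                     ≈⟨ trans (*-identityʳ _) (*-identityʳ _) ⟩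
    1#                               ∎
    where
    off-diagonal : ∀ j → j ≢ zero → laplaceTerm n δ j ≈ 0#
    off-diagonal j j≢0 = trans (*-congʳ (trans (*-congˡ (reflexive (δ-≢ (j≢0 ∘ ≡.sym)))) (zeroʳ _))) (zeroˡ _)

  det-ᵀ : ∀ n M → det n (M ᵀ) ≈ det n M
  det-ᵀ n M = sym (begin
    det n M                   ≈⟨ alternatingForm≈det n (det-multilinear n) (det-alternating n) M ⟩
    det n (M ᵀ) * det n δ     ≈⟨ *-congˡ (det-δ n) ⟩
    det n (M ᵀ) * 1#          ≈⟨ *-identityʳ _ ⟩
    det n (M ᵀ)               ∎)

  ·-setCol : ∀ {n} (N M : Mat n) j v → N · setCol M j v ≋ setCol (N · M) j (λ r → ∑[ l < n ] (N r l * v l))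
  ·-setCol N M j v r c with c ≟ j
  ... | yes _ = refl
  ... | no _  = refl

  det-·-multilinear : ∀ n (N : Mat n) → IsMultilinear n (λ M → det n (N · M))
  det-·-multilinear n N = record
    { D-cong   = λ M≋M′ → det-cong n λ r c → sum-cong-≋ λ l → *-congˡ (M≋M′ l c)
    ; D-linear = linear
    }
    where
    N* : (Fin n → A) → Fin n → A
    N* u r = ∑[ l < n ] (N r l * u l)
    N*-linear : ∀ a u v r → N* (λ l → a * u l + v l) r ≈ a * N* u r + N* v r
    N*-linear a u v r = begin
      ∑[ l < n ] (N r l * (a * u l + v l))
        ≈⟨ sum-cong-≋ (λ l → solve 4 (λ x a u v → x :* (a :* u :+ v) := a :* (x :* u) :+ x :* v) refl (N r l) a (u l) (v l)) ⟩
      ∑[ l < n ] (a * (N r l * u l) + N r l * v l)    ≈⟨ ∑-distrib-+ (λ l → a * (N r l * u l)) (λ l → N r l * v l) ⟩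
      ∑[ l < n ] (a * (N r l * u l)) + N* v r         ≈⟨ +-congʳ (*-distribˡ-sum a (λ l → N r l * u l)) ⟨
      a * N* u r + N* v r                             ∎
    linear : ∀ M j a (u v : Fin n → A) →
             det n (N · setCol M j (λ r → a * u r + v r)) ≈ a * det n (N · setCol M j u) + det n (N · setCol M j v)
    linear M j a u v = begin
      det n (N · setCol M j (λ r → a * u r + v r))           ≈⟨ det-cong n (·-setCol N M j _) ⟩
      det n (setCol (N · M) j (N* (λ r → a * u r + v r)))    ≈⟨ det-cong n (setCol-cong (N · M) j (N*-linear a u v)) ⟩
      det n (setCol (N · M) j (λ r → a * N* u r + N* v r))   ≈⟨ det-linear n (N · M) j a (N* u) (N* v) ⟩
      a * det n (setCol (N · M) j (N* u)) + det n (setCol (N · M) j (N* v))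
        ≈⟨ +-cong (*-congˡ (det-cong n (·-setCol N M j u))) (det-cong n (·-setCol N M j v)) ⟨
      a * det n (N · setCol M j u) + det n (N · setCol M j v) ∎

  det-· : ∀ n (N M : Mat n) → det n (N · M) ≈ det n N * det n M
  det-· n N M = begin
    det n (N · M)                  ≈⟨ alternatingForm≈det n (det-·-multilinear n N) alternating M ⟩
    det n (M ᵀ) * det n (N · δ)    ≈⟨ *-cong (det-ᵀ n M) (det-cong n N·δ≋N) ⟩
    det n M * det n N              ≈⟨ *-comm _ _ ⟩
    det n N * det n M              ∎
    where
    alternating : IsAlternating n (λ M → det n (N · M))
    alternating M i≢j Mi≈Mj = det-alternating n (N · M) i≢j λ r → sum-cong-≋ λ l → *-congˡ (Mi≈Mj l)
    N·δ≋N : N · δ ≋ N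
    N·δ≋N r c = trans (sum-cong-≋ λ l → *-congˡ (reflexive (δ-sym l c))) (sum-δ (N r) c)

  sign-punchIn : ∀ {n} (j : Fin (suc (suc n))) (m j′ : Fin (suc n)) → punchIn (punchIn j m) j′ ≡ j →
                 sign (toℕ (punchIn j m) ℕ.+ toℕ j′) ≈ - sign (toℕ j ℕ.+ toℕ m)
  sign-punchIn zero m zero _ =
    trans (reflexive (≡.cong (sign ∘ suc) (ℕₚ.+-identityʳ (toℕ m)))) (sign-suc (toℕ m))
  sign-punchIn zero m (suc j′) ()
  sign-punchIn (suc j) zero j′ eq with Finₚ.suc-injective eq
  ... | ≡.refl = begin
    sign (toℕ j′)                   ≈⟨ -‿involutive _ ⟨
    - - sign (toℕ j′)               ≈⟨ -‿cong (sign-suc (toℕ j′)) ⟨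
    - sign (suc (toℕ j′))           ≡⟨ ≡.cong (λ k → - sign (suc k)) (ℕₚ.+-identityʳ (toℕ j′)) ⟨
    - sign (suc (toℕ j′ ℕ.+ 0))     ∎
  sign-punchIn {suc n} (suc j) (suc m) zero ()
  sign-punchIn {suc n} (suc j) (suc m) (suc j′) eq = begin
    sign (suc (toℕ (punchIn j m) ℕ.+ suc (toℕ j′)))  ≡⟨ ≡.cong (sign ∘ suc) (ℕₚ.+-suc (toℕ (punchIn j m)) (toℕ j′)) ⟩
    sign (toℕ (punchIn j m) ℕ.+ toℕ j′)              ≈⟨ sign-punchIn j m j′ (Finₚ.suc-injective eq) ⟩
    - sign (toℕ j ℕ.+ toℕ m)                         ≡⟨ ≡.cong (λ k → - sign (suc k)) (ℕₚ.+-suc (toℕ j) (toℕ m)) ⟨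
    - sign (suc (toℕ j ℕ.+ suc (toℕ m)))             ∎

  det-unitCol : ∀ n (M : Mat (suc n)) (i j : Fin (suc n)) a → (∀ r → M r j ≈ a * δ r i) →
                det (suc n) M ≈ sign (toℕ i ℕ.+ toℕ j) * a * det n (minor i j M)
  det-unitCol n M zero j a Mj≈aeᵢ = begin
    det (suc n) M                                    ≈⟨ sum-single (laplaceTerm n M) j others ⟩
    sign (toℕ j) * M zero j * det n (minor zero j M) ≈⟨ *-congʳ (*-congˡ (trans (Mj≈aeᵢ zero) (*-identityʳ a))) ⟩
    sign (toℕ j) * a * det n (minor zero j M)        ∎
    where
    others : ∀ l → l ≢ j → laplaceTerm n M l ≈ 0#
    others l l≢j = trans (*-congˡ (Multilinear.D-zeroCol (det-multilinear n) (minor zero l M) (punchOut l≢j) col≈0)) (zeroʳ _)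
      where
      col≈0 : ∀ r → M (suc r) (punchIn l (punchOut l≢j)) ≈ 0#
      col≈0 r = trans (reflexive (≡.cong (M (suc r)) (Finₚ.punchIn-punchOut l≢j))) (trans (Mj≈aeᵢ (suc r)) (zeroʳ a))
  det-unitCol (suc n) M (suc i) j a Mj≈aeᵢ = begin
    det (suc (suc n)) M                                       ≈⟨ sum-remove {i = j} (laplaceTerm (suc n) M) ⟩
    laplaceTerm (suc n) M j + ∑[ m < suc n ] laplaceTerm (suc n) M (punchIn j m)
      ≈⟨ +-cong term-j (sum-cong-≋ term) ⟩
    0# + ∑[ m < suc n ] (S * laplaceTerm n (minor (suc i) j M) m) ≈⟨ +-identityˡ _ ⟩
    ∑[ m < suc n ] (S * laplaceTerm n (minor (suc i) j M) m)    ≈⟨ *-distribˡ-sum S (laplaceTerm n (minor (suc i) j M)) ⟨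
    S * det (suc n) (minor (suc i) j M)                         ∎
    where
    S = sign (suc (toℕ i ℕ.+ toℕ j)) * a
    term-j : laplaceTerm (suc n) M j ≈ 0#
    term-j = trans (*-congʳ (trans (*-congˡ (trans (Mj≈aeᵢ zero) (zeroʳ a))) (zeroʳ _))) (zeroˡ _)
    term : ∀ m → laplaceTerm (suc n) M (punchIn j m) ≈ S * laplaceTerm n (minor (suc i) j M) m
    term m = begin
      sl * m₀ * det (suc n) (minor zero l M)
        ≈⟨ *-congˡ (det-unitCol n (minor zero l M) i j′ a col-j′) ⟩
      sl * m₀ * (sign (toℕ i ℕ.+ toℕ j′) * a * det n (minor i j′ (minor zero l M)))
        ≈⟨ *-congˡ (*-cong (*-congʳ (sign-+ (toℕ i) (toℕ j′))) (det-cong n minors≋)) ⟩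
      sl * m₀ * (si * sj′ * a * d)
        ≈⟨ solve 6 (λ sl m₀ si sj′ a d → sl :* m₀ :* (si :* sj′ :* a :* d) := sl :* sj′ :* (si :* a :* (m₀ :* d)))
                 refl sl m₀ si sj′ a d ⟩
      sl * sj′ * (si * a * (m₀ * d))
        ≈⟨ *-congʳ (trans (sym (sign-+ (toℕ l) (toℕ j′))) (trans (sign-punchIn j m j′ lj′≡j) (-‿cong (sign-+ (toℕ j) (toℕ m))))) ⟩
      - (sj * sm) * (si * a * (m₀ * d))
        ≈⟨ -‿distribˡ-* _ _ ⟨
      - (sj * sm * (si * a * (m₀ * d)))
        ≈⟨ -‿cong (solve 6 (λ sj sm si a m₀ d → sj :* sm :* (si :* a :* (m₀ :* d)) := si :* sj :* a :* (sm :* m₀ :* d))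
                          refl sj sm si a m₀ d) ⟩
      - (si * sj * a * (sm * m₀ * d))
        ≈⟨ -‿distribˡ-* _ _ ⟩
      - (si * sj * a) * (sm * m₀ * d)
        ≈⟨ *-congʳ (trans (-‿distribˡ-* _ _) (*-congʳ (sym (trans (sign-suc (toℕ i ℕ.+ toℕ j)) (-‿cong (sign-+ (toℕ i) (toℕ j))))))) ⟩
      S * (sm * m₀ * d) ∎
      where
      l = punchIn j m
      l≢j : l ≢ j
      l≢j = Finₚ.punchInᵢ≢i j m
      j′ = punchOut l≢j
      lj′≡j : punchIn l j′ ≡ j
      lj′≡j = Finₚ.punchIn-punchOut l≢j
      sl = sign (toℕ l)
      sm = sign (toℕ m)
      si = sign (toℕ i)
      sj = sign (toℕ j)
      sj′ = sign (toℕ j′)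
      m₀ = M zero l
      d = det n (minor zero m (minor (suc i) j M))
      col-j′ : ∀ r → minor zero l M r j′ ≈ a * δ r i
      col-j′ r = trans (reflexive (≡.cong (M (suc r)) lj′≡j)) (trans (Mj≈aeᵢ (suc r)) (reflexive (≡.cong (a *_) (if-≟-punchIn zero r i))))
      minors≋ : minor i j′ (minor zero l M) ≋ minor zero m (minor (suc i) j M)
      minors≋ r c = reflexive (≡.cong (M (suc (punchIn i r))) (punchIn-punchIn j m j′ lj′≡j c))

  principal : ∀ {n} → Mat n → (l : List (Fin n)) → Mat (List.length l)
  principal M l i j = M (List.lookup l i) (List.lookup l j)

  det-cast : ∀ {m n} (eq : m ≡ n) (N : Mat n) → det m (λ r c → N (Fin.cast eq r) (Fin.cast eq c)) ≈ det n N
  det-cast ≡.refl N = det-cong _ λ r c → reflexive (≡.cong₂ N (Finₚ.cast-is-id ≡.refl r) (Finₚ.cast-is-id ≡.refl c))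

  det-principal-map : ∀ {m n} (f : Fin m → Fin n) l (M : Mat n) →
    det (List.length l) (principal (λ r c → M (f r) (f c)) l) ≈ det (List.length (List.map f l)) (principal M (List.map f l))
  det-principal-map f l M = trans
    (det-cong _ λ r c → reflexive (≡.sym (≡.cong₂ M (lookup-map-cast f l r) (lookup-map-cast f l c))))
    (det-cast (≡.sym (Listₚ.length-map f l)) (principal M (List.map f l)))

  det-principal-⊤ : ∀ n (M : Mat n) → det n M ≈ det (List.length (members (⊤ {n}))) (principal M (members ⊤))
  det-principal-⊤ n M = trans
    (det-cong n λ r c → reflexive (≡.sym (≡.cong₂ M (lookup-members-⊤ n r) (lookup-members-⊤ n c))))
    (det-cast (length-members-⊤ n) (principal M (members ⊤)))

  det-unitCols : ∀ n (M : Mat n) (γ : Subset n) a → (∀ c → Vec.lookup γ c ≡ false → ∀ r → M r c ≈ a * δ r c) →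
                 det n M ≈ a ^ ∣ ∁ γ ∣ * det (List.length (members γ)) (principal M (members γ))
  det-unitCols n M γ a unit with outside-or-⊤ γ
  ... | inj₂ ≡.refl = begin
    det n M                    ≈⟨ det-principal-⊤ n M ⟩
    det⊤                       ≈⟨ *-identityˡ _ ⟨
    1# * det⊤                  ≡⟨ ≡.cong (λ k → a ^ k * det⊤) (∣∁⊤∣≡0 n) ⟨
    a ^ ∣ ∁ (⊤ {n}) ∣ * det⊤   ∎
    where det⊤ = det (List.length (members (⊤ {n}))) (principal M (members ⊤))
  det-unitCols (suc n) M γ a unit | inj₁ (j , γj≡false) = begin
    det (suc n) M                                         ≈⟨ det-unitCol n M j j a (unit j γj≡false) ⟩
    sign (toℕ j ℕ.+ toℕ j) * a * det n (minor j j M)      ≈⟨ *-congʳ (trans (*-congʳ (sign-double (toℕ j))) (*-identityˡ a)) ⟩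
    a * det n (minor j j M)                               ≈⟨ *-congˡ (det-unitCols n (minor j j M) γ′ a unit′) ⟩
    a * (a ^ ∣ ∁ γ′ ∣ * det _ (principal (minor j j M) l′)) ≈⟨ *-assoc _ _ _ ⟨
    a ^ suc ∣ ∁ γ′ ∣ * det _ (principal (minor j j M) l′)   ≈⟨ *-congˡ (det-principal-map (punchIn j) l′ M) ⟩
    a ^ suc ∣ ∁ γ′ ∣ * det _ (principal M (List.map (punchIn j) l′))
      ≡⟨ ≡.cong₂ (λ k l → a ^ k * det (List.length l) (principal M l)) (∣∁∣-removeAt γ j γj≡false) (members-removeAt γ j γj≡false) ⟨
    a ^ ∣ ∁ γ ∣ * det _ (principal M (members γ))          ∎
    where
    γ′ = removeAt γ j
    l′ = members γ′
    unit′ : ∀ c → Vec.lookup γ′ c ≡ false → ∀ r → minor j j M r c ≈ a * δ r c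
    unit′ c γ′c≡false r = trans (unit (punchIn j c) (≡.trans (≡.sym (lookup-removeAt γ j c)) γ′c≡false) (punchIn j r))
                                (reflexive (≡.cong (a *_) (if-≟-punchIn j r c)))
  det-unitCols zero M γ a unit | inj₁ (() , _)

  1^n≈1 : ∀ n → 1# ^ n ≈ 1#
  1^n≈1 zero    = refl
  1^n≈1 (suc n) = trans (*-identityˡ _) (1^n≈1 n)

  jacobi : ∀ {n} (M : Mat n) k → M · M ᵀ ≋ (λ r c → k * δ r c) → (α : Subset n) →
           det n M * det _ (principal M (members (∁ α))) ≈ k ^ ∣ ∁ α ∣ * det _ (principal M (members α))
  jacobi {n} M k M·Mᵀ≋kI α = begin
    det n M * det _ (principal M (members (∁ α)))  ≈⟨ *-congˡ det-E ⟨
    det n M * det n E                               ≈⟨ det-· n M E ⟨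
    det n (M · E)                                   ≈⟨ det-cong n M·E≋M′ ⟩
    det n M′                                        ≈⟨ det-unitCols n M′ α k unit ⟩
    k ^ ∣ ∁ α ∣ * det _ (principal M′ (members α))   ≈⟨ *-congˡ (det-cong _ principal-M′) ⟩
    k ^ ∣ ∁ α ∣ * det _ (principal M (members α))    ∎
    where
    -- Column c of M · E is column c of M if c ∈ α, and k e_c otherwise.
    E : Mat n
    E r c = if Vec.lookup α c then δ r c else M c r
    M′ : Mat n
    M′ r c = if Vec.lookup α c then M r c else k * δ r c
    M·E≋M′ : M · E ≋ M′
    M·E≋M′ r c with Vec.lookup α c
    ... | true  = trans (sum-cong-≋ λ l → *-congˡ (reflexive (δ-sym l c))) (sum-δ (M r) c)
    ... | false = M·Mᵀ≋kI r c
    unit : ∀ c → Vec.lookup α c ≡ false → ∀ r → M′ r c ≈ k * δ r c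
    unit c αc≡false r rewrite αc≡false = refl
    principal-M′ : principal M′ (members α) ≋ principal M (members α)
    principal-M′ i j rewrite lookup-members α j = refl
    ∁α = members (∁ α)
    unitE : ∀ c → Vec.lookup (∁ α) c ≡ false → ∀ r → E r c ≈ 1# * δ r c
    unitE c ∁αc≡false r with Vec.lookup α c in αc
    ... | true  = sym (*-identityˡ _)
    ... | false = ⊥-elim (true≢false (≡.trans (≡.sym (≡.trans (Vecₚ.lookup-map c not α) (≡.cong not αc))) ∁αc≡false))
    principal-E : principal E ∁α ≋ principal M ∁α ᵀ
    principal-E i j with Vec.lookup α (List.lookup ∁α j) in αj
    ... | true  = ⊥-elim (true≢false (≡.trans (≡.sym (lookup-members (∁ α) j)) (≡.trans (Vecₚ.lookup-map _ not α) (≡.cong not αj))))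
    ... | false = refl
    det-E : det n E ≈ det _ (principal M ∁α)
    det-E = begin
      det n E                                       ≈⟨ det-unitCols n E (∁ α) 1# unitE ⟩
      1# ^ ∣ ∁ (∁ α) ∣ * det _ (principal E ∁α)      ≈⟨ *-cong (1^n≈1 ∣ ∁ (∁ α) ∣) (det-cong _ principal-E) ⟩
      1# * det _ (principal M ∁α ᵀ)                  ≈⟨ *-identityˡ _ ⟩
      det _ (principal M ∁α ᵀ)                       ≈⟨ det-ᵀ (List.length ∁α) (principal M ∁α) ⟩
      det _ (principal M ∁α)                         ∎

  det²-orthogonal : ∀ {n} (M : Mat n) k → M · M ᵀ ≋ (λ r c → k * δ r c) → det n M * det n M ≈ k ^ n
  det²-orthogonal {n} M k M·Mᵀ≋kI = begin
    det n M * det n M                                              ≈⟨ *-congˡ (det-principal-⊤ n M) ⟩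
    det n M * det _ (principal M (members (⊤ {n})))                ≡⟨ ≡.cong (λ γ → det n M * det _ (principal M (members γ))) (∁⊥≡⊤ n) ⟨
    det n M * det _ (principal M (members (∁ (⊥ {n}))))            ≈⟨ jacobi M k M·Mᵀ≋kI ⊥ ⟩
    k ^ ∣ ∁ (⊥ {n}) ∣ * det _ (principal M (members (⊥ {n})))      ≡⟨ ≡.cong₂ (λ e l → k ^ e * det (List.length l) (principal M l)) ∣∁⊥∣≡n (members-⊥ n) ⟩
    k ^ n * 1#                                                     ≈⟨ *-identityʳ _ ⟩
    k ^ n                                                          ∎
    where
    ∣∁⊥∣≡n : ∣ ∁ (⊥ {n}) ∣ ≡ n
    ∣∁⊥∣≡n = ≡.trans (∣∁p∣≡n∸∣p∣ (⊥ {n})) (≡.cong (n ℕ.∸_) (∣⊥∣≡0 n))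

  ·ᵀ-skew-shift : ∀ {n} x (T : Mat n) k (M : Mat n) →
                  (∀ r c → M r c ≈ x * δ r c + T r c) → (∀ r c → T c r + T r c ≈ 0#) →
                  T · T ᵀ ≋ (λ r c → k * δ r c) → M · M ᵀ ≋ (λ r c → (x * x + k) * δ r c)
  ·ᵀ-skew-shift {n} x T k M M≈xI+T skew T·Tᵀ≋kI r c = begin
    ∑[ l < n ] (M r l * M c l)
      ≈⟨ sum-cong-≋ (λ l → trans (*-cong (M≈xI+T r l) (M≈xI+T c l))
           (solve 5 (λ x dr dc tr tc → (x :* dr :+ tr) :* (x :* dc :+ tc) :=
              x :* x :* dc :* dr :+ (x :* tc :* dr :+ (x :* tr :* dc :+ tr :* tc))) refl x (δ r l) (δ c l) (T r l) (T c l))) ⟩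
    ∑[ l < n ] (x * x * δ c l * δ r l + (x * T c l * δ r l + (x * T r l * δ c l + T r l * T c l)))
      ≈⟨ trans (∑-distrib-+ t₁ _) (+-congˡ (trans (∑-distrib-+ t₂ _) (+-congˡ (∑-distrib-+ t₃ t₄)))) ⟩
    ∑[ l < n ] (x * x * δ c l * δ r l) + (∑[ l < n ] (x * T c l * δ r l)
      + (∑[ l < n ] (x * T r l * δ c l) + ∑[ l < n ] (T r l * T c l)))
      ≈⟨ +-cong (sum-δ _ r) (+-cong (sum-δ _ r) (+-cong (sum-δ _ c) (T·Tᵀ≋kI r c))) ⟩
    x * x * δ c r + (x * T c r + (x * T r c + k * δ r c))
      ≈⟨ +-cong (reflexive (≡.cong (x * x *_) (δ-sym r c))) (+-assoc _ _ _) ⟨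
    x * x * δ r c + ((x * T c r + x * T r c) + k * δ r c)
      ≈⟨ +-congˡ (+-congʳ (trans (sym (distribˡ x (T c r) (T r c))) (trans (*-congˡ (skew r c)) (zeroʳ x)))) ⟩
    x * x * δ r c + (0# + k * δ r c)
      ≈⟨ trans (+-congˡ (+-identityˡ _)) (sym (distribʳ (δ r c) (x * x) k)) ⟩
    (x * x + k) * δ r c ∎
    where
    t₁ t₂ t₃ t₄ : Fin n → A
    t₁ l = x * x * δ c l * δ r l
    t₂ l = x * T c l * δ r l
    t₃ l = x * T r l * δ c l
    t₄ l = T r l * T c l


module Cancellation {c ℓ} (R : CommutativeRing c ℓ) where

  open CommutativeRing R
  open import Algebra.Definitions _≈_ using (AlmostLeftCancellative)
  open import Algebra.Properties.Ring ring using (x∙y⁻¹≈ε⇒x≈y; x≈y⇒x∙y⁻¹≈ε; x[y-z]≈xy-xz; -‿distribˡ-*)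
  open import Relation.Binary.Reasoning.Setoid setoid

  module _ (no-zero-divisors : ∀ {x y} → x * y ≈ 0# → x ≈ 0# ⊎ y ≈ 0#) where

    *-cancelˡ-nonZero : AlmostLeftCancellative 0# _*_
    *-cancelˡ-nonZero x y z x≉0 xy≈xz with no-zero-divisors (trans (x[y-z]≈xy-xz x y z) (x≈y⇒x∙y⁻¹≈ε xy≈xz))
    ... | inj₁ x≈0   = ⊥-elim (x≉0 x≈0)
    ... | inj₂ y-z≈0 = x∙y⁻¹≈ε⇒x≈y y z y-z≈0

    square-injective : ∀ {x y} → x * x ≈ y * y → ¬ x + y ≈ 0# → x ≈ y
    square-injective {x} {y} xx≈yy x+y≉0 with no-zero-divisors [x-y][x+y]≈0
      where
      [x-y][x+y]≈0 : (x - y) * (x + y) ≈ 0#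
      [x-y][x+y]≈0 = begin
        (x - y) * (x + y)                    ≈⟨ distribʳ (x + y) x (- y) ⟩
        x * (x + y) + - y * (x + y)          ≈⟨ +-cong (distribˡ x x y) (trans (sym (-‿distribˡ-* y (x + y))) (-‿cong (distribˡ y x y))) ⟩
        (x * x + x * y) - (y * x + y * y)    ≈⟨ +-congʳ (+-cong xx≈yy (*-comm x y)) ⟩
        (y * y + y * x) - (y * x + y * y)    ≈⟨ +-congʳ (+-comm _ _) ⟩
        (y * x + y * y) - (y * x + y * y)    ≈⟨ -‿inverseʳ _ ⟩
        0#                                   ∎
    ... | inj₁ x-y≈0 = x∙y⁻¹≈ε⇒x≈y x y x-y≈0
    ... | inj₂ x+y≈0 = ⊥-elim (x+y≉0 x+y≈0)

module IntegerPolynomial where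

  open import Defs using (Poly; coeff; _≈ₚ_; _+ₚ_; negₚ; _*ₚ_; oneₚ)
  open import Data.Integer using (ℤ; 0ℤ; 1ℤ; -_; _+_; _*_)
  import Data.Integer.Properties as ℤₚ
  open import Data.Integer.Solver using (module +-*-Solver)
  open +-*-Solver using (solve; _:=_; _:+_; _:*_)
  open ≡ using (refl; sym; trans; cong; cong₂)

  scale : ℤ → Poly → Poly
  scale a = List.map (a *_)

  coeff-+ₚ : ∀ p q i → coeff (p +ₚ q) i ≡ coeff p i + coeff q i
  coeff-+ₚ []      q       i       = sym (ℤₚ.+-identityˡ _)
  coeff-+ₚ (a ∷ p) []      i       = sym (ℤₚ.+-identityʳ _)
  coeff-+ₚ (a ∷ p) (b ∷ q) zero    = refl
  coeff-+ₚ (a ∷ p) (b ∷ q) (suc i) = coeff-+ₚ p q i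

  coeff-negₚ : ∀ p i → coeff (negₚ p) i ≡ - coeff p i
  coeff-negₚ []      i       = refl
  coeff-negₚ (a ∷ p) zero    = refl
  coeff-negₚ (a ∷ p) (suc i) = coeff-negₚ p i

  coeff-scale : ∀ a q i → coeff (scale a q) i ≡ a * coeff q i
  coeff-scale a []      i       = sym (ℤₚ.*-zeroʳ a)
  coeff-scale a (b ∷ q) zero    = refl
  coeff-scale a (b ∷ q) (suc i) = coeff-scale a q i

  coeff-∷*ₚ : ∀ a p q i → coeff ((a ∷ p) *ₚ q) i ≡ a * coeff q i + coeff (0ℤ ∷ (p *ₚ q)) i
  coeff-∷*ₚ a p q i = trans (coeff-+ₚ (scale a q) (0ℤ ∷ (p *ₚ q)) i) (cong (_+ coeff (0ℤ ∷ (p *ₚ q)) i) (coeff-scale a q i))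

  -- A record wrapper around _≈ₚ_, so that both polynomials can be inferred from a proof.
  infix 4 _≃ₚ_
  record _≃ₚ_ (p q : Poly) : Set where
    constructor coeffwise
    field coeff-≡ : p ≈ₚ q
  open _≃ₚ_ public

  ≃ₚ-refl : ∀ {p} → p ≃ₚ p
  ≃ₚ-refl = coeffwise λ i → refl

  ≃ₚ-sym : ∀ {p q} → p ≃ₚ q → q ≃ₚ p
  ≃ₚ-sym (coeffwise e) = coeffwise λ i → sym (e i)

  ≃ₚ-trans : ∀ {p q r} → p ≃ₚ q → q ≃ₚ r → p ≃ₚ r
  ≃ₚ-trans (coeffwise e) (coeffwise f) = coeffwise λ i → trans (e i) (f i)

  +ₚ-cong : ∀ {p p′ q q′} → p ≃ₚ p′ → q ≃ₚ q′ → p +ₚ q ≃ₚ p′ +ₚ q′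
  +ₚ-cong {p} {p′} {q} {q′} (coeffwise e) (coeffwise f) =
    coeffwise λ i → trans (coeff-+ₚ p q i) (trans (cong₂ _+_ (e i) (f i)) (sym (coeff-+ₚ p′ q′ i)))

  negₚ-cong : ∀ {p q} → p ≃ₚ q → negₚ p ≃ₚ negₚ q
  negₚ-cong {p} {q} (coeffwise e) = coeffwise λ i → trans (coeff-negₚ p i) (trans (cong -_ (e i)) (sym (coeff-negₚ q i)))

  scale-cong : ∀ a {q q′} → q ≃ₚ q′ → scale a q ≃ₚ scale a q′
  scale-cong a {q} {q′} (coeffwise e) =
    coeffwise λ i → trans (coeff-scale a q i) (trans (cong (a *_) (e i)) (sym (coeff-scale a q′ i)))

  ∷-cong : ∀ {a b p q} → a ≡ b → p ≃ₚ q → (a ∷ p) ≃ₚ (b ∷ q)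
  ∷-cong a≡b (coeffwise e) = coeffwise λ { zero → a≡b ; (suc i) → e i }

  *ₚ-congˡ : ∀ p {q q′} → q ≃ₚ q′ → p *ₚ q ≃ₚ p *ₚ q′
  *ₚ-congˡ []      e = ≃ₚ-refl
  *ₚ-congˡ (a ∷ p) e = +ₚ-cong (scale-cong a e) (∷-cong refl (*ₚ-congˡ p e))

  ≈ₚ[]⇒*ₚ≈ₚ[] : ∀ p q → p ≈ₚ [] → p *ₚ q ≈ₚ []
  ≈ₚ[]⇒*ₚ≈ₚ[] []      q e i       = refl
  ≈ₚ[]⇒*ₚ≈ₚ[] (a ∷ p) q e zero    =
    trans (coeff-∷*ₚ a p q zero) (trans (cong (λ x → x * coeff q 0 + 0ℤ) (e zero)) refl)
  ≈ₚ[]⇒*ₚ≈ₚ[] (a ∷ p) q e (suc i) = trans (coeff-∷*ₚ a p q (suc i))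
    (cong₂ (λ x y → x * coeff q (suc i) + y) (e zero) (≈ₚ[]⇒*ₚ≈ₚ[] p q (e ∘ suc) i))

  *ₚ-congʳ : ∀ {p p′} q → p ≃ₚ p′ → p *ₚ q ≃ₚ p′ *ₚ q
  *ₚ-congʳ {[]}    {[]}      q e = ≃ₚ-refl
  *ₚ-congʳ {[]}    {a′ ∷ p′} q (coeffwise e) = ≃ₚ-sym (coeffwise (≈ₚ[]⇒*ₚ≈ₚ[] (a′ ∷ p′) q (sym ∘ e)))
  *ₚ-congʳ {a ∷ p} {[]}      q (coeffwise e) = coeffwise (≈ₚ[]⇒*ₚ≈ₚ[] (a ∷ p) q e)
  *ₚ-congʳ {a ∷ p} {a′ ∷ p′} q (coeffwise e) with e zero
  ... | refl = +ₚ-cong ≃ₚ-refl (∷-cong refl (*ₚ-congʳ {p} {p′} q (coeffwise (e ∘ suc))))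

  +ₚ-assoc : ∀ p q r → (p +ₚ q) +ₚ r ≃ₚ p +ₚ (q +ₚ r)
  +ₚ-assoc p q r = coeffwise λ i → begin
    coeff ((p +ₚ q) +ₚ r) i                ≡⟨ coeff-+ₚ (p +ₚ q) r i ⟩
    coeff (p +ₚ q) i + coeff r i           ≡⟨ cong (_+ coeff r i) (coeff-+ₚ p q i) ⟩
    coeff p i + coeff q i + coeff r i      ≡⟨ ℤₚ.+-assoc (coeff p i) (coeff q i) (coeff r i) ⟩
    coeff p i + (coeff q i + coeff r i)    ≡⟨ cong (coeff p i +_) (coeff-+ₚ q r i) ⟨
    coeff p i + coeff (q +ₚ r) i           ≡⟨ coeff-+ₚ p (q +ₚ r) i ⟨
    coeff (p +ₚ (q +ₚ r)) i                ∎
    where open ≡.≡-Reasoning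

  +ₚ-comm : ∀ p q → p +ₚ q ≃ₚ q +ₚ p
  +ₚ-comm p q = coeffwise λ i → trans (coeff-+ₚ p q i) (trans (ℤₚ.+-comm (coeff p i) (coeff q i)) (sym (coeff-+ₚ q p i)))

  +ₚ-identityʳ : ∀ p → p +ₚ [] ≃ₚ p
  +ₚ-identityʳ p = coeffwise λ i → trans (coeff-+ₚ p [] i) (ℤₚ.+-identityʳ (coeff p i))

  negₚ-inverseˡ : ∀ p → negₚ p +ₚ p ≃ₚ []
  negₚ-inverseˡ p = coeffwise λ i →
    trans (coeff-+ₚ (negₚ p) p i) (trans (cong (_+ coeff p i) (coeff-negₚ p i)) (ℤₚ.+-inverseˡ (coeff p i)))

  negₚ-inverseʳ : ∀ p → p +ₚ negₚ p ≃ₚ []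
  negₚ-inverseʳ p = ≃ₚ-trans (+ₚ-comm p (negₚ p)) (negₚ-inverseˡ p)

  *ₚ-identityˡ : ∀ p → oneₚ *ₚ p ≃ₚ p
  *ₚ-identityˡ p = coeffwise λ i → trans (coeff-∷*ₚ 1ℤ [] p i)
    (trans (cong (1ℤ * coeff p i +_) (coeff-0∷[] i)) (trans (ℤₚ.+-identityʳ _) (ℤₚ.*-identityˡ _)))
    where
    coeff-0∷[] : ∀ i → coeff (0ℤ ∷ []) i ≡ 0ℤ
    coeff-0∷[] zero    = refl
    coeff-0∷[] (suc i) = refl

  *ₚ-distribʳ : ∀ p q r → (q +ₚ r) *ₚ p ≃ₚ q *ₚ p +ₚ r *ₚ p
  *ₚ-distribʳ p []      r       = ≃ₚ-refl
  *ₚ-distribʳ p (a ∷ q) []      = ≃ₚ-sym (+ₚ-identityʳ ((a ∷ q) *ₚ p))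
  *ₚ-distribʳ p (a ∷ q) (b ∷ r) = coeffwise λ i → begin
    coeff ((a + b ∷ (q +ₚ r)) *ₚ p) i
      ≡⟨ coeff-∷*ₚ (a + b) (q +ₚ r) p i ⟩
    (a + b) * coeff p i + coeff (0ℤ ∷ ((q +ₚ r) *ₚ p)) i
      ≡⟨ cong ((a + b) * coeff p i +_) (tail-distrib i) ⟩
    (a + b) * coeff p i + (coeff (0ℤ ∷ (q *ₚ p)) i + coeff (0ℤ ∷ (r *ₚ p)) i)
      ≡⟨ solve 5 (λ a b x y z → (a :+ b) :* x :+ (y :+ z) := (a :* x :+ y) :+ (b :* x :+ z)) refl a b (coeff p i) _ _ ⟩
    (a * coeff p i + coeff (0ℤ ∷ (q *ₚ p)) i) + (b * coeff p i + coeff (0ℤ ∷ (r *ₚ p)) i)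
      ≡⟨ cong₂ _+_ (coeff-∷*ₚ a q p i) (coeff-∷*ₚ b r p i) ⟨
    coeff ((a ∷ q) *ₚ p) i + coeff ((b ∷ r) *ₚ p) i
      ≡⟨ coeff-+ₚ ((a ∷ q) *ₚ p) ((b ∷ r) *ₚ p) i ⟨
    coeff ((a ∷ q) *ₚ p +ₚ (b ∷ r) *ₚ p) i ∎
    where
    open ≡.≡-Reasoning
    tail-distrib : ∀ i → coeff (0ℤ ∷ ((q +ₚ r) *ₚ p)) i ≡ coeff (0ℤ ∷ (q *ₚ p)) i + coeff (0ℤ ∷ (r *ₚ p)) i
    tail-distrib zero    = refl
    tail-distrib (suc i) = trans (coeff-≡ (*ₚ-distribʳ p q r) i) (coeff-+ₚ (q *ₚ p) (r *ₚ p) i)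

  *ₚ-[] : ∀ p → p *ₚ [] ≈ₚ []
  *ₚ-[] []      i       = refl
  *ₚ-[] (a ∷ p) zero    = refl
  *ₚ-[] (a ∷ p) (suc i) = *ₚ-[] p i

  *ₚ-∷ : ∀ p b q → p *ₚ (b ∷ q) ≈ₚ scale b p +ₚ (0ℤ ∷ (p *ₚ q))
  *ₚ-∷ []      b q zero    = refl
  *ₚ-∷ []      b q (suc i) = refl
  *ₚ-∷ (a ∷ p) b q zero    = cong (_+ 0ℤ) (ℤₚ.*-comm a b)
  *ₚ-∷ (a ∷ p) b q (suc i) = begin
    coeff (scale a q +ₚ p *ₚ (b ∷ q)) i                        ≡⟨ coeff-+ₚ (scale a q) (p *ₚ (b ∷ q)) i ⟩
    coeff (scale a q) i + coeff (p *ₚ (b ∷ q)) i               ≡⟨ cong₂ _+_ (coeff-scale a q i) (trans (*ₚ-∷ p b q i) (coeff-+ₚ (scale b p) _ i)) ⟩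
    a * coeff q i + (coeff (scale b p) i + coeff (0ℤ ∷ (p *ₚ q)) i)
      ≡⟨ solve 3 (λ x y z → x :+ (y :+ z) := y :+ (x :+ z)) refl (a * coeff q i) (coeff (scale b p) i) (coeff (0ℤ ∷ (p *ₚ q)) i) ⟩
    coeff (scale b p) i + (a * coeff q i + coeff (0ℤ ∷ (p *ₚ q)) i)  ≡⟨ cong (coeff (scale b p) i +_) (coeff-∷*ₚ a p q i) ⟨
    coeff (scale b p) i + coeff ((a ∷ p) *ₚ q) i               ≡⟨ coeff-+ₚ (scale b p) ((a ∷ p) *ₚ q) i ⟨
    coeff (scale b p +ₚ (a ∷ p) *ₚ q) i                        ∎
    where open ≡.≡-Reasoning

  *ₚ-comm : ∀ p q → p *ₚ q ≃ₚ q *ₚ p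
  *ₚ-comm []      q = ≃ₚ-sym (coeffwise (*ₚ-[] q))
  *ₚ-comm (a ∷ p) q = ≃ₚ-sym (≃ₚ-trans (coeffwise (*ₚ-∷ q a p)) (+ₚ-cong ≃ₚ-refl (∷-cong refl (*ₚ-comm q p))))

  *ₚ-distribˡ : ∀ p q r → p *ₚ (q +ₚ r) ≃ₚ p *ₚ q +ₚ p *ₚ r
  *ₚ-distribˡ p q r = ≃ₚ-trans (*ₚ-comm p (q +ₚ r)) (≃ₚ-trans (*ₚ-distribʳ p q r) (+ₚ-cong (*ₚ-comm q p) (*ₚ-comm r p)))

  scale-*ₚ : ∀ a q r → scale a q *ₚ r ≃ₚ scale a (q *ₚ r)
  scale-*ₚ a []      r = ≃ₚ-refl
  scale-*ₚ a (b ∷ q) r = coeffwise λ i → begin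
    coeff ((a * b ∷ scale a q) *ₚ r) i                                 ≡⟨ coeff-∷*ₚ (a * b) (scale a q) r i ⟩
    a * b * coeff r i + coeff (0ℤ ∷ (scale a q *ₚ r)) i                ≡⟨ cong (a * b * coeff r i +_) (tail i) ⟩
    a * b * coeff r i + a * coeff (0ℤ ∷ (q *ₚ r)) i                    ≡⟨ solve 4 (λ a b x y → a :* b :* x :+ a :* y := a :* (b :* x :+ y)) refl a b _ _ ⟩
    a * (b * coeff r i + coeff (0ℤ ∷ (q *ₚ r)) i)                      ≡⟨ cong (a *_) (coeff-∷*ₚ b q r i) ⟨
    a * coeff ((b ∷ q) *ₚ r) i                                         ≡⟨ coeff-scale a ((b ∷ q) *ₚ r) i ⟨
    coeff (scale a ((b ∷ q) *ₚ r)) i                                   ∎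
    where
    open ≡.≡-Reasoning
    tail : ∀ i → coeff (0ℤ ∷ (scale a q *ₚ r)) i ≡ a * coeff (0ℤ ∷ (q *ₚ r)) i
    tail zero    = sym (ℤₚ.*-zeroʳ a)
    tail (suc i) = trans (coeff-≡ (scale-*ₚ a q r) i) (coeff-scale a (q *ₚ r) i)

  *ₚ-assoc : ∀ p q r → (p *ₚ q) *ₚ r ≃ₚ p *ₚ (q *ₚ r)
  *ₚ-assoc []      q r = ≃ₚ-refl
  *ₚ-assoc (a ∷ p) q r = ≃ₚ-trans (*ₚ-distribʳ r (scale a q) (0ℤ ∷ (p *ₚ q)))
    (+ₚ-cong (scale-*ₚ a q r) (≃ₚ-trans (0∷-*ₚ (p *ₚ q)) (∷-cong refl (*ₚ-assoc p q r))))
    where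
    0∷-*ₚ : ∀ s → (0ℤ ∷ s) *ₚ r ≃ₚ 0ℤ ∷ (s *ₚ r)
    0∷-*ₚ s = coeffwise λ i → trans (coeff-∷*ₚ 0ℤ s r i)
      (trans (cong (_+ coeff (0ℤ ∷ (s *ₚ r)) i) (ℤₚ.*-zeroˡ (coeff r i))) (ℤₚ.+-identityˡ _))

  ∷-≈ₚ[] : ∀ {a p} → a ≡ 0ℤ → p ≈ₚ [] → (a ∷ p) ≈ₚ []
  ∷-≈ₚ[] a≡0 p≈[] zero    = a≡0
  ∷-≈ₚ[] a≡0 p≈[] (suc i) = p≈[] i

  *ₚ-noZeroDivisors : ∀ p q → p *ₚ q ≈ₚ [] → p ≈ₚ [] ⊎ q ≈ₚ []
  *ₚ-noZeroDivisors []      q       _  = inj₁ λ i → refl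
  *ₚ-noZeroDivisors (a ∷ p) []      _  = inj₂ λ i → refl
  *ₚ-noZeroDivisors (a ∷ p) (b ∷ q) pq≈[] =
    [ (λ a≡0 → Sum.map₁ (∷-≈ₚ[] a≡0) (*ₚ-noZeroDivisors p (b ∷ q) (p*bq≈[] a≡0)))
    , (λ b≡0 → Sum.map₂ (∷-≈ₚ[] b≡0) (*ₚ-noZeroDivisors (a ∷ p) q (ap*q≈[] b≡0)))
    ]′ (ℤₚ.i*j≡0⇒i≡0∨j≡0 a (trans (sym (ℤₚ.+-identityʳ (a * b))) (pq≈[] zero)))
    where
    open ≡.≡-Reasoning
    p*bq≈[] : a ≡ 0ℤ → p *ₚ (b ∷ q) ≈ₚ []
    p*bq≈[] a≡0 i = begin
      coeff (p *ₚ (b ∷ q)) i                                ≡⟨ ℤₚ.+-identityˡ _ ⟨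
      0ℤ + coeff (p *ₚ (b ∷ q)) i                           ≡⟨ cong (λ x → x * coeff (b ∷ q) (suc i) + coeff (p *ₚ (b ∷ q)) i) a≡0 ⟨
      a * coeff (b ∷ q) (suc i) + coeff (p *ₚ (b ∷ q)) i    ≡⟨ coeff-∷*ₚ a p (b ∷ q) (suc i) ⟨
      coeff ((a ∷ p) *ₚ (b ∷ q)) (suc i)                    ≡⟨ pq≈[] (suc i) ⟩
      0ℤ                                                    ∎
    ap*q≈[] : b ≡ 0ℤ → (a ∷ p) *ₚ q ≈ₚ []
    ap*q≈[] b≡0 i = begin
      coeff ((a ∷ p) *ₚ q) i                                   ≡⟨ ℤₚ.+-identityˡ _ ⟨
      0ℤ + coeff ((a ∷ p) *ₚ q) i                              ≡⟨ cong (λ x → x * coeff (a ∷ p) (suc i) + coeff ((a ∷ p) *ₚ q) i) b≡0 ⟨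
      b * coeff (a ∷ p) (suc i) + coeff ((a ∷ p) *ₚ q) i       ≡⟨ cong (_+ coeff ((a ∷ p) *ₚ q) i) (coeff-scale b p i) ⟨
      coeff (scale b p) i + coeff ((a ∷ p) *ₚ q) i             ≡⟨ coeff-+ₚ (scale b p) ((a ∷ p) *ₚ q) i ⟨
      coeff (scale b p +ₚ (a ∷ p) *ₚ q) i                      ≡⟨ *ₚ-∷ (a ∷ p) b q (suc i) ⟨
      coeff ((a ∷ p) *ₚ (b ∷ q)) (suc i)                       ≡⟨ pq≈[] (suc i) ⟩
      0ℤ                                                       ∎

  noZeroDivisors : ∀ {p q} → p *ₚ q ≃ₚ [] → p ≃ₚ [] ⊎ q ≃ₚ []
  noZeroDivisors {p} {q} (coeffwise pq≈[]) = Sum.map coeffwise coeffwise (*ₚ-noZeroDivisors p q pq≈[])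

  ℤ[X] : CommutativeRing _ _
  ℤ[X] = record
    { isCommutativeRing = record
      { isRing = record
        { +-isAbelianGroup = record
          { isGroup = record
            { isMonoid = record
              { isSemigroup = record
                { isMagma = record
                  { isEquivalence = record { refl = ≃ₚ-refl ; sym = ≃ₚ-sym ; trans = ≃ₚ-trans }
                  ; ∙-cong = +ₚ-cong }
                ; assoc = +ₚ-assoc }
              ; identity = (λ p → ≃ₚ-refl) , +ₚ-identityʳ }
            ; inverse = negₚ-inverseˡ , negₚ-inverseʳ
            ; ⁻¹-cong = negₚ-cong }
          ; comm = +ₚ-comm }
        ; *-cong = λ {p} {p′} {q} e f → ≃ₚ-trans (*ₚ-congʳ q e) (*ₚ-congˡ p′ f)
        ; *-assoc = *ₚ-assoc
        ; *-identity = *ₚ-identityˡ , (λ p → ≃ₚ-trans (*ₚ-comm p oneₚ) (*ₚ-identityˡ p))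
        ; distrib = *ₚ-distribˡ , *ₚ-distribʳ }
      ; *-comm = *ₚ-comm } }

module PolynomialDegree where

  open import Defs using (Poly; coeff; _+ₚ_; _*ₚ_; _^ₚ_; constₚ; oneₚ; Xₚ; δ)
  open import Data.Integer using (0ℤ; 1ℤ; _+_; _*_)
  import Data.Integer.Properties as ℤₚ
  open IntegerPolynomial
  open ≡ using (refl; sym; trans; cong; cong₂)
  module D = Determinant ℤ[X]

  Degree≤ : Poly → ℕ → Set
  Degree≤ p d = ∀ i → d ℕ.< i → coeff p i ≡ 0ℤ

  degree-+ₚ : ∀ {p q d} → Degree≤ p d → Degree≤ q d → Degree≤ (p +ₚ q) d
  degree-+ₚ {p} {q} p≤d q≤d i d<i = trans (coeff-+ₚ p q i) (cong₂ _+_ (p≤d i d<i) (q≤d i d<i))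

  degree-*ₚ-top : ∀ p q a b → Degree≤ p a → Degree≤ q b →
                  Degree≤ (p *ₚ q) (a ℕ.+ b) × coeff (p *ₚ q) (a ℕ.+ b) ≡ coeff p a * coeff q b
  degree-*ₚ-top []      q a b _ _ = (λ i _ → refl) , sym (ℤₚ.*-zeroˡ (coeff q b))
  degree-*ₚ-top (x ∷ p) q zero b p≤0 q≤b = degree , top
    where
    0∷pq≈[] : ∀ i → coeff (0ℤ ∷ (p *ₚ q)) i ≡ 0ℤ
    0∷pq≈[] zero    = refl
    0∷pq≈[] (suc i) = ≈ₚ[]⇒*ₚ≈ₚ[] p q (λ i → p≤0 (suc i) (ℕ.s≤s ℕ.z≤n)) i
    degree : Degree≤ ((x ∷ p) *ₚ q) b
    degree i b<i = trans (coeff-∷*ₚ x p q i)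
      (trans (cong₂ _+_ (cong (x *_) (q≤b i b<i)) (0∷pq≈[] i)) (trans (ℤₚ.+-identityʳ _) (ℤₚ.*-zeroʳ x)))
    top : coeff ((x ∷ p) *ₚ q) b ≡ x * coeff q b
    top = trans (coeff-∷*ₚ x p q b) (trans (cong (x * coeff q b +_) (0∷pq≈[] b)) (ℤₚ.+-identityʳ _))
  degree-*ₚ-top (x ∷ p) q (suc a) b p≤1+a q≤b = degree , top
    where
    ih = degree-*ₚ-top p q a b (λ i a<i → p≤1+a (suc i) (ℕ.s≤s a<i)) q≤b
    degree : Degree≤ ((x ∷ p) *ₚ q) (suc a ℕ.+ b)
    degree zero    ()
    degree (suc i) (ℕ.s≤s a+b<i) = trans (coeff-∷*ₚ x p q (suc i))
      (trans (cong₂ _+_ (cong (x *_) (q≤b (suc i) (ℕ.s≤s (ℕₚ.≤-trans (ℕₚ.m≤n+m b a) (ℕₚ.<⇒≤ a+b<i))))) (proj₁ ih i a+b<i))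
             (trans (ℤₚ.+-identityʳ _) (ℤₚ.*-zeroʳ x)))
    top : coeff ((x ∷ p) *ₚ q) (suc a ℕ.+ b) ≡ coeff p a * coeff q b
    top = trans (coeff-∷*ₚ x p q (suc (a ℕ.+ b)))
      (trans (cong₂ _+_ (cong (x *_) (q≤b (suc (a ℕ.+ b)) (ℕ.s≤s (ℕₚ.m≤n+m b a)))) (proj₂ ih))
             (trans (cong (_+ (coeff p a * coeff q b)) (ℤₚ.*-zeroʳ x)) (ℤₚ.+-identityˡ _)))

  degree-*ₚ : ∀ p q {a b} → Degree≤ p a → Degree≤ q b → Degree≤ (p *ₚ q) (a ℕ.+ b)
  degree-*ₚ p q {a} {b} p≤a q≤b = proj₁ (degree-*ₚ-top p q a b p≤a q≤b)

  coeff-*ₚ-top : ∀ p q {a b} → Degree≤ p a → Degree≤ q b → coeff (p *ₚ q) (a ℕ.+ b) ≡ coeff p a * coeff q b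
  coeff-*ₚ-top p q {a} {b} p≤a q≤b = proj₂ (degree-*ₚ-top p q a b p≤a q≤b)

  monic-quadratic-^ₚ : ∀ k m → let q = Xₚ *ₚ Xₚ +ₚ constₚ k in
                       Degree≤ (q ^ₚ m) (2 ℕ.* m) × coeff (q ^ₚ m) (2 ℕ.* m) ≡ 1ℤ
  monic-quadratic-^ₚ k zero    = (λ { (suc i) _ → refl }) , refl
  monic-quadratic-^ₚ k (suc m) = ≡.subst (λ d → Degree≤ (q ^ₚ suc m) d × coeff (q ^ₚ suc m) d ≡ 1ℤ) (sym (ℕₚ.*-suc 2 m))
    (degree-*ₚ q (q ^ₚ m) q≤2 (proj₁ ih) , trans (coeff-*ₚ-top q (q ^ₚ m) q≤2 (proj₁ ih)) (cong (1ℤ *_) (proj₂ ih)))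
    where
    q = Xₚ *ₚ Xₚ +ₚ constₚ k
    ih = monic-quadratic-^ₚ k m
    q≤2 : Degree≤ q 2
    q≤2 (suc (suc (suc i))) _ = refl
    q≤2 (suc zero)       (ℕ.s≤s ())
    q≤2 (suc (suc zero)) (ℕ.s≤s (ℕ.s≤s ()))

  degree-sign : ∀ k → Degree≤ (D.sign k) 0
  degree-sign zero          (suc i) _ = refl
  degree-sign (suc zero)    (suc i) _ = refl
  degree-sign (suc (suc k))         = degree-sign k

  degree-sum : ∀ {n} (f : Fin n → Poly) {d} → (∀ j → Degree≤ (f j) d) → Degree≤ (D.sum f) d
  degree-sum {zero}  f f≤d i _ = refl
  degree-sum {suc n} f {d} f≤d = degree-+ₚ {f zero} {D.sum (f ∘ suc)} {d} (f≤d zero) (degree-sum (f ∘ suc) (f≤d ∘ suc))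

  degree-det : ∀ n (M : D.Mat n) → (∀ r c → Degree≤ (M r c) 1) → Degree≤ (D.det n M) n
  degree-det zero    M M≤1 (suc i) _ = refl
  degree-det (suc n) M M≤1 = degree-sum (D.laplaceTerm n M) λ j →
    degree-*ₚ (D.sign (toℕ j) *ₚ M zero j) (D.det n (D.minor zero j M)) (degree-*ₚ (D.sign (toℕ j)) (M zero j) (degree-sign (toℕ j)) (M≤1 zero j))
              (degree-det n (D.minor zero j M) (λ r c → M≤1 (suc r) (punchIn j c)))

  det-monic : ∀ n (M : D.Mat n) → (∀ r c → Degree≤ (M r c) 1) → (∀ r c → coeff (M r c) 1 ≡ δ r c) →
              coeff (D.det n M) n ≡ 1ℤ
  det-monic zero    M _   _   = refl
  det-monic (suc n) M M≤1 M₁≡δ = trans (coeff-+ₚ (D.laplaceTerm n M zero) (D.sum (D.laplaceTerm n M ∘ suc)) (suc n))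
    (cong₂ _+_ diagonal-term other-terms)
    where
    minor≤1 : ∀ j r c → Degree≤ (D.minor zero j M r c) 1
    minor≤1 j r c = M≤1 (suc r) (punchIn j c)
    diagonal-term : coeff (D.laplaceTerm n M zero) (suc n) ≡ 1ℤ
    diagonal-term = begin
      coeff (D.laplaceTerm n M zero) (1 ℕ.+ n)
        ≡⟨ coeff-*ₚ-top (oneₚ *ₚ M zero zero) (D.det n (D.minor zero zero M))
                        (degree-*ₚ oneₚ (M zero zero) (degree-sign 0) (M≤1 zero zero)) (degree-det n _ (minor≤1 zero)) ⟩
      coeff (oneₚ *ₚ M zero zero) 1 * coeff (D.det n (D.minor zero zero M)) n
        ≡⟨ cong₂ _*_ (trans (coeff-*ₚ-top oneₚ (M zero zero) (degree-sign 0) (M≤1 zero zero)) (cong (1ℤ *_) (M₁≡δ zero zero)))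
                     (det-monic n _ (minor≤1 zero) (λ r c → trans (M₁≡δ (suc r) (suc c)) (if-≟-punchIn zero r c))) ⟩
      1ℤ * 1ℤ ∎
      where open ≡.≡-Reasoning
    degree-0 : ∀ j → Degree≤ (M zero (suc j)) 0
    degree-0 j (suc zero)    _ = M₁≡δ zero (suc j)
    degree-0 j (suc (suc i)) _ = M≤1 zero (suc j) (suc (suc i)) (ℕ.s≤s (ℕ.s≤s ℕ.z≤n))
    other-terms : coeff (D.sum (D.laplaceTerm n M ∘ suc)) (suc n) ≡ 0ℤ
    other-terms = degree-sum (D.laplaceTerm n M ∘ suc) {n}
      (λ j → degree-*ₚ (D.sign (toℕ (suc j)) *ₚ M zero (suc j)) (D.det n (D.minor zero (suc j) M))
               (degree-*ₚ (D.sign (toℕ (suc j))) (M zero (suc j)) (degree-sign (toℕ (suc j))) (degree-0 j))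
               (degree-det n (D.minor zero (suc j) M) (minor≤1 (suc j))))
      (suc n) (ℕₚ.n<1+n n)

module SkewConference where

  open import Defs
  open import Data.Integer as ℤ using (ℤ; +_; 0ℤ; 1ℤ; -_)
  import Data.Integer.Properties as ℤₚ
  open import Data.Integer.Solver using (module +-*-Solver)
  open IntegerPolynomial
  open PolynomialDegree using (Degree≤; det-monic; monic-quadratic-^ₚ)
  module D = Determinant ℤ[X]
  open import Data.Fin.Subset using (Subset; ∁; ∣_∣)
  open import Data.Fin.Subset.Properties using (∣∁p∣≡n∸∣p∣)
  open CommutativeRing ℤ[X] using (_*_; setoid; trans; reflexive; +-cong; *-cong; *-congˡ; *-congʳ; *-assoc; *-identityʳ; zeroʳ)
  open Cancellation ℤ[X] using (*-cancelˡ-nonZero; square-injective)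
  open import Algebra.Properties.Semiring.Exp (CommutativeRing.semiring ℤ[X]) using (_^_; ^-homo-*)
  open import Relation.Binary.Reasoning.Setoid setoid

  sumPoly≡sum : ∀ n f → sumPoly n f ≡ D.sum f
  sumPoly≡sum zero    f = ≡.refl
  sumPoly≡sum (suc n) f = ≡.cong (f zero +ₚ_) (sumPoly≡sum n (f ∘ suc))

  signPoly≡sign : ∀ k → signPoly k ≡ D.sign k
  signPoly≡sign zero          = ≡.refl
  signPoly≡sign (suc zero)    = ≡.refl
  signPoly≡sign (suc (suc k)) = signPoly≡sign k

  det≃ₚdet : ∀ n (M : Matrix Poly n) → det n M ≃ₚ D.det n M
  det≃ₚdet zero    M = ≃ₚ-refl
  det≃ₚdet (suc n) M = ≡.subst (_≃ₚ D.det (suc n) M) (≡.sym (sumPoly≡sum (suc n) term)) (D.sum-cong-≋ term≃ₚ)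
    where
    term : Fin (suc n) → Poly
    term j = signPoly (toℕ j) *ₚ M zero j *ₚ det n (D.minor zero j M)
    term≃ₚ : ∀ j → term j ≃ₚ D.laplaceTerm n M j
    term≃ₚ j = *-cong (reflexive (≡.cong (_*ₚ M zero j) (signPoly≡sign (toℕ j)))) (det≃ₚdet n (D.minor zero j M))

  ^ₚ≡^ : ∀ p k → p ^ₚ k ≡ p ^ k
  ^ₚ≡^ p zero    = ≡.refl
  ^ₚ≡^ p (suc k) = ≡.cong (p *ₚ_) (^ₚ≡^ p k)

  constₚ-0 : constₚ 0ℤ ≃ₚ []
  constₚ-0 = coeffwise λ { zero → ≡.refl ; (suc i) → ≡.refl }

  constₚ-* : ∀ a b → constₚ a *ₚ constₚ b ≃ₚ constₚ (a ℤ.* b)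
  constₚ-* a b = coeffwise λ { zero → ℤₚ.+-identityʳ _ ; (suc i) → ≡.refl }

  constₚ-sum : ∀ n (f : Fin n → ℤ) → D.sum (constₚ ∘ f) ≃ₚ constₚ (sumFin n f)
  constₚ-sum zero    f = ≃ₚ-sym constₚ-0
  constₚ-sum (suc n) f = +-cong ≃ₚ-refl (constₚ-sum n (f ∘ suc))

  constₚ-δ : ∀ {n} (r c : Fin n) → constₚ (δ r c) ≃ₚ D.δ r c
  constₚ-δ r c with r ≟ c
  ... | yes _ = ≃ₚ-refl
  ... | no _  = constₚ-0

  module _ (n : ℕ) (S : Matrix ℤ n) (S-skewConference : IsSkewConference n S) where

    open IsSkewConference S-skewConference

    q : Poly
    q = Xₚ *ₚ Xₚ +ₚ constₚ ((+ n) ℤ.- 1ℤ)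

    xI-S : D.Mat n
    xI-S r c = (if ⌊ r ≟ c ⌋ then Xₚ else []) -ₚ constₚ (S r c)

    xI-S·ᵀ : xI-S D.· xI-S D.ᵀ D.≋ λ r c → q * D.δ r c
    xI-S·ᵀ = D.·ᵀ-skew-shift Xₚ (λ r c → constₚ (- S r c)) (constₚ ((+ n) ℤ.- 1ℤ)) xI-S xI-S≃xI+T skew′ S·Sᵀ
      where
      xI-S≃xI+T : ∀ r c → xI-S r c ≃ₚ Xₚ * D.δ r c +ₚ constₚ (- S r c)
      xI-S≃xI+T r c with r ≟ c
      ... | yes _ = +-cong (≃ₚ-sym (*-identityʳ Xₚ)) (≃ₚ-refl {constₚ (- S r c)})
      ... | no _  = +-cong (≃ₚ-sym (zeroʳ Xₚ)) (≃ₚ-refl {constₚ (- S r c)})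
      skew′ : ∀ r c → constₚ (- S c r) +ₚ constₚ (- S r c) ≃ₚ []
      skew′ r c = ≃ₚ-trans (reflexive (≡.cong constₚ (≡.trans (≡.cong (λ x → - x ℤ.+ - S r c) (skew r c))
        (≡.trans (≡.cong (ℤ._+ - S r c) (ℤₚ.neg-involutive (S r c))) (ℤₚ.+-inverseʳ (S r c)))))) constₚ-0
      neg*neg : ∀ a b → (- a) ℤ.* (- b) ≡ a ℤ.* b
      neg*neg = solve 2 (λ a b → (:- a) :* (:- b) := a :* b) ≡.refl
        where open +-*-Solver
      S·Sᵀ : ∀ r c → D.sum (λ l → constₚ (- S r l) *ₚ constₚ (- S c l)) ≃ₚ constₚ ((+ n) ℤ.- 1ℤ) * D.δ r c
      S·Sᵀ r c = begin
        D.sum (λ l → constₚ (- S r l) *ₚ constₚ (- S c l))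
          ≈⟨ D.sum-cong-≋ (λ l → ≃ₚ-trans (constₚ-* (- S r l) (- S c l)) (reflexive (≡.cong constₚ (neg*neg (S r l) (S c l))))) ⟩
        D.sum (λ l → constₚ (S r l ℤ.* S c l))          ≈⟨ constₚ-sum n (λ l → S r l ℤ.* S c l) ⟩
        constₚ (sumFin n (λ l → S r l ℤ.* S c l))       ≡⟨ ≡.cong constₚ (orth r c) ⟩
        constₚ (((+ n) ℤ.- 1ℤ) ℤ.* δ r c)               ≈⟨ constₚ-* ((+ n) ℤ.- 1ℤ) (δ r c) ⟨
        constₚ ((+ n) ℤ.- 1ℤ) *ₚ constₚ (δ r c)         ≈⟨ *-congˡ {constₚ ((+ n) ℤ.- 1ℤ)} (constₚ-δ r c) ⟩
        constₚ ((+ n) ℤ.- 1ℤ) * D.δ r c                 ∎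

    charPoly-principal : ∀ γ → charPoly (principal S (members γ)) ≃ₚ D.det _ (D.principal xI-S (members γ))
    charPoly-principal γ = ≃ₚ-trans (det≃ₚdet _ (λ i j → (if ⌊ i ≟ j ⌋ then Xₚ else []) -ₚ constₚ (principal S (members γ) i j)))
      (D.det-cong _ λ i j →
      reflexive (≡.cong (_-ₚ constₚ (principal S (members γ) i j)) (≡.sym (if-≟-injective (members-lookupInjective γ) i j))))

    det-xI-S-monic : coeff (D.det n xI-S) n ≡ 1ℤ
    det-xI-S-monic = det-monic n xI-S degree≤1 coeff₁≡δ
      where
      degree≤1 : ∀ r c → Degree≤ (xI-S r c) 1
      degree≤1 r c with r ≟ c
      ... | yes _ = λ { zero () ; (suc zero) (ℕ.s≤s ()) ; (suc (suc i)) _ → ≡.refl }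
      ... | no _  = λ { zero () ; (suc zero) (ℕ.s≤s ()) ; (suc (suc i)) _ → ≡.refl }
      coeff₁≡δ : ∀ r c → coeff (xI-S r c) 1 ≡ δ r c
      coeff₁≡δ r c with r ≟ c
      ... | yes _ = ≡.refl
      ... | no _  = ≡.refl

    coeff-q^ : ∀ m → coeff (q ^ m) (2 ℕ.* m) ≡ 1ℤ
    coeff-q^ m = ≡.trans (≡.cong (λ p → coeff p (2 ℕ.* m)) (≡.sym (^ₚ≡^ q m))) (proj₂ (monic-quadratic-^ₚ ((+ n) ℤ.- 1ℤ) m))

    q^≉0 : ∀ m → ¬ q ^ m ≃ₚ []
    q^≉0 m (coeffwise q^m≈[]) = 1≢0 (≡.trans (≡.sym (coeff-q^ m)) (q^m≈[] (2 ℕ.* m)))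
      where
      1≢0 : 1ℤ ≢ 0ℤ
      1≢0 ()

    det≃q^half : ∀ m → n ≡ m ℕ.+ m → D.det n xI-S ≃ₚ q ^ m
    det≃q^half m n≡m+m = square-injective noZeroDivisors det² det+q^m≉0
      where
      det² : D.det n xI-S * D.det n xI-S ≃ₚ q ^ m * q ^ m
      det² = trans (D.det²-orthogonal xI-S q xI-S·ᵀ) (trans (reflexive (≡.cong (q ^_) n≡m+m)) (^-homo-* q m m))
      2m≡n : 2 ℕ.* m ≡ n
      2m≡n = ≡.trans (≡.cong (m ℕ.+_) (ℕₚ.+-identityʳ m)) (≡.sym n≡m+m)
      -- Both summands are monic of degree n.
      det+q^m≉0 : ¬ D.det n xI-S +ₚ q ^ m ≃ₚ []
      det+q^m≉0 (coeffwise det+q^m≈[]) = 2≢0 (≡.trans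
        (≡.cong₂ ℤ._+_ (≡.sym det-xI-S-monic) (≡.subst (λ i → 1ℤ ≡ coeff (q ^ m) i) 2m≡n (≡.sym (coeff-q^ m))))
        (≡.trans (≡.sym (coeff-+ₚ (D.det n xI-S) (q ^ m) n)) (det+q^m≈[] n)))
        where
        2≢0 : 1ℤ ℤ.+ 1ℤ ≢ 0ℤ
        2≢0 ()

    det-principal-complement : ∀ m → n ≡ m ℕ.+ m → (α : Subset n) → ∣ α ∣ ℕ.≤ m →
      q ^ (m ℕ.∸ ∣ α ∣) * D.det _ (D.principal xI-S (members α)) ≃ₚ D.det _ (D.principal xI-S (members (∁ α)))
    det-principal-complement m n≡m+m α ∣α∣≤m = *-cancelˡ-nonZero noZeroDivisors (q ^ m) _ _ (q^≉0 m) (begin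
      q ^ m * (q ^ (m ℕ.∸ ∣ α ∣) * Dα)    ≈⟨ *-assoc (q ^ m) (q ^ (m ℕ.∸ ∣ α ∣)) Dα ⟨
      q ^ m * q ^ (m ℕ.∸ ∣ α ∣) * Dα      ≈⟨ *-congʳ (^-homo-* q m (m ℕ.∸ ∣ α ∣)) ⟨
      q ^ (m ℕ.+ (m ℕ.∸ ∣ α ∣)) * Dα      ≡⟨ ≡.cong (λ e → q ^ e * Dα) ∣∁α∣≡m+[m∸∣α∣] ⟨
      q ^ ∣ ∁ α ∣ * Dα                    ≈⟨ D.jacobi xI-S q xI-S·ᵀ α ⟨
      D.det n xI-S * D∁α                  ≈⟨ *-congʳ (det≃q^half m n≡m+m) ⟩
      q ^ m * D∁α                         ∎)
      where
      Dα = D.det _ (D.principal xI-S (members α))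
      D∁α = D.det _ (D.principal xI-S (members (∁ α)))
      ∣∁α∣≡m+[m∸∣α∣] : ∣ ∁ α ∣ ≡ m ℕ.+ (m ℕ.∸ ∣ α ∣)
      ∣∁α∣≡m+[m∸∣α∣] = ≡.trans (∣∁p∣≡n∸∣p∣ α) (≡.trans (≡.cong (ℕ._∸ ∣ α ∣) n≡m+m) (ℕₚ.+-∸-assoc m ∣α∣≤m))

    charPoly-complement : ∀ m → n ≡ m ℕ.+ m → (α : Subset n) → ∣ α ∣ ℕ.≤ m →
                          q ^ₚ (m ℕ.∸ ∣ α ∣) *ₚ charPoly (S [ α ]) ≃ₚ charPoly (S ⟨ α ⟩)
    charPoly-complement m n≡m+m α ∣α∣≤m = begin
      q ^ₚ (m ℕ.∸ ∣ α ∣) *ₚ charPoly (S [ α ])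
        ≈⟨ *-cong (reflexive (^ₚ≡^ q (m ℕ.∸ ∣ α ∣))) (charPoly-principal α) ⟩
      q ^ (m ℕ.∸ ∣ α ∣) * D.det _ (D.principal xI-S (members α))
        ≈⟨ det-principal-complement m n≡m+m α ∣α∣≤m ⟩
      D.det _ (D.principal xI-S (members (∁ α)))
        ≈⟨ charPoly-principal (∁ α) ⟨
      charPoly (S ⟨ α ⟩) ∎

open import Defs
open import Data.Nat using (ℕ; _*_; _∸_; _/_; _≤_)
open import Data.Nat.Divisibility using (_∣_; divides)
open import Data.Nat.DivMod using (m*n/n≡m)
open import Data.Integer as ℤ using (ℤ; +_; 1ℤ)
open import Data.Fin.Subset using (Subset; ∣_∣)

corollary7p2 : (n : ℕ) (S : Matrix ℤ n) → IsSkewConference n S → 2 ∣ n →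
    (α : Subset n) → 2 * ∣ α ∣ ≤ n →
    ((Xₚ *ₚ Xₚ +ₚ constₚ ((+ n) ℤ.- 1ℤ)) ^ₚ (n / 2 ∸ ∣ α ∣)) *ₚ charPoly (S [ α ])
    ≈ₚ charPoly (S ⟨ α ⟩)
corollary7p2 n S S-skewConference (divides m n≡m*2) α 2∣α∣≤n =
  ≡.subst (λ h → (Xₚ *ₚ Xₚ +ₚ constₚ ((+ n) ℤ.- 1ℤ)) ^ₚ (h ∸ ∣ α ∣) *ₚ charPoly (S [ α ]) ≈ₚ charPoly (S ⟨ α ⟩))
          (≡.sym n/2≡m)
          (IntegerPolynomial.coeff-≡ (SkewConference.charPoly-complement n S S-skewConference m n≡m+m α ∣α∣≤m))
  where
  n≡2*m : n ≡ 2 * m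
  n≡2*m = ≡.trans n≡m*2 (ℕₚ.*-comm m 2)
  n≡m+m : n ≡ m ℕ.+ m
  n≡m+m = ≡.trans n≡2*m (≡.cong (m ℕ.+_) (ℕₚ.+-identityʳ m))
  n/2≡m : n / 2 ≡ m
  n/2≡m = ≡.trans (≡.cong (_/ 2) n≡m*2) (m*n/n≡m m 2)
  ∣α∣≤m : ∣ α ∣ ≤ m
  ∣α∣≤m = ℕₚ.*-cancelˡ-≤ 2 (≡.subst (2 * ∣ α ∣ ≤_) n≡2*m 2∣α∣≤n)
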